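{- There exists $\gamma_0>0$ such that for every $0<\gamma\leq\gamma_0$ there exists $\lambda_0>0$ such that for every $0<\lambda\leq\lambda_0$ there exists $\eta_0>0$ such that for every $0<\eta\leq\eta_0$ there exists $n_0$ such that for every $n\geq n_0$ the following holds. Let $G$ be a standard multigraph on $n$ vertices with $\delta(G)\geq(3/2-2\eta)n$ which is not $(1/4,\gamma)$-extremal and not $(1/4,\gamma)$-splittable. Then for any disjoint sets $U_1,U_2\subseteq V(G)$ with $|U_1|,|U_2|\geq(1/2-\gamma/5)n$, there exists a collection $\mathcal T$ of copies of elements of $\bar{\mathcal K}_3$ in $G[U_1\cup U_2]$ such that $|\mathcal T|\geq\lambda n^3$ and, for every $T\in\mathcal T$, both $V(T)\cap U_1$ and $V(T)\cap U_2$ are non-empty, and if $T$ contains a light edge $u_1u_2$ then $u_1\in U_1$ and $u_2\in U_2$.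
   Context: A standard multigraph is a loopless multigraph in which any two distinct vertices $x,y$ are joined by $\mu(xy)\in\{0,1,2\}$ edges (light if $1$, heavy if $2$); degrees and $e(\cdot)$ count edges with multiplicity, $e_2(\cdot)$ counts heavy edges; $e_2(U_1,U_2)$ counts heavy edges between disjoint sets. $G$ on $n$ vertices is $(1/4,\gamma)$-extremal if either there is $S\subseteq V(G)$ with $||S|-n/4|<\gamma n$ and $e(G[S])<\gamma n^2$, or there is $S$ with $||S|-n/2|<\gamma n$ and $e_2(G[S])<\gamma n^2$. $G$ is $(1/4,\gamma)$-splittable if there are disjoint $U_1,U_2\subseteq V(G)$ with $|U_1|,|U_2|\geq(1/2-\gamma)n$ and $e_2(U_1,U_2)\leq\gamma n^2$. $\bar{\mathcal K}_3$ is the family of standard multigraphs on $3$ vertices with all pairs heavy except possibly one light pair; a copy of an element of $\bar{\mathcal K}_3$ in $G$ is a triple of vertices with all pairs heavy except at most one pair, which is light (its light edge being that pair).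
   Formalization: The parameters γ, λ and η range only over the positive rationals, and the thresholds γ₀, λ₀ and η₀ are taken in the rationals as well. -}

module Defs where

open import Data.Nat using (ℕ; zero; suc; _<ᵇ_; _≡ᵇ_) renaming (_≤_ to _≤ℕ_; _<_ to _<ℕ_)
open import Data.Fin using (Fin; toℕ)
open import Data.Fin.Subset using (Subset; _∈_; _∉_; ∣_∣)
open import Data.Vec using (lookup)
open import Data.List using (List; map; allFin; length)
open import Data.Nat.ListAction using (sum)
open import Data.List.Relation.Unary.All using (All)
open import Data.List.Relation.Unary.Unique.Propositional using (Unique)
open import Data.Bool using (Bool; true; false; _∧_; if_then_else_)
open import Data.Integer using (+_)
open import Data.Rational using (ℚ; _/_; _*_; _-_; _+_; _<_; _≤_; ½; 1ℚ) renaming (∣_∣ to abs)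
open import Data.Product using (Σ; _×_; _,_)
open import Data.Sum using (_⊎_)
open import Relation.Binary.PropositionalEquality using (_≡_)

ℕ→ℚ : ℕ → ℚ
ℕ→ℚ n = + n / 1

¼ : ℚ
¼ = + 1 / 4

record StdMultigraph (n : ℕ) : Set where
  field
    μ      : Fin n → Fin n → ℕ
    μ-≤2   : ∀ x y → μ x y ≤ℕ 2
    μ-sym  : ∀ x y → μ x y ≡ μ y x
    μ-loop : ∀ x → μ x x ≡ 0

open StdMultigraph public

Σv : {n : ℕ} → (Fin n → ℕ) → ℕ
Σv {n} f = sum (map f (allFin n))

deg : {n : ℕ} → StdMultigraph n → Fin n → ℕ
deg G x = Σv (λ y → μ G x y)

heavyᵇ : {n : ℕ} → StdMultigraph n → Fin n → Fin n → ℕ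
heavyᵇ G x y = if μ G x y ≡ᵇ 2 then 1 else 0

eIn : {n : ℕ} → StdMultigraph n → Subset n → ℕ
eIn G S = Σv (λ x → Σv (λ y →
  if lookup S x ∧ lookup S y ∧ (toℕ x <ᵇ toℕ y) then μ G x y else 0))

e₂In : {n : ℕ} → StdMultigraph n → Subset n → ℕ
e₂In G S = Σv (λ x → Σv (λ y →
  if lookup S x ∧ lookup S y ∧ (toℕ x <ᵇ toℕ y) then heavyᵇ G x y else 0))

e₂Between : {n : ℕ} → StdMultigraph n → Subset n → Subset n → ℕ
e₂Between G U₁ U₂ = Σv (λ x → Σv (λ y →
  if lookup U₁ x ∧ lookup U₂ y then heavyᵇ G x y else 0))

Disjoint : {n : ℕ} → Subset n → Subset n → Set
Disjoint U₁ U₂ = ∀ x → x ∈ U₁ → x ∉ U₂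

MinDegAtLeast : {n : ℕ} → StdMultigraph n → ℚ → Set
MinDegAtLeast G d = ∀ x → d ≤ ℕ→ℚ (deg G x)

Extremal : {n : ℕ} → ℚ → StdMultigraph n → Set
Extremal {n} γ G =
  Σ (Subset n) (λ S → abs (ℕ→ℚ ∣ S ∣ - ¼ * ℕ→ℚ n) < γ * ℕ→ℚ n
                    × ℕ→ℚ (eIn G S) < γ * ℕ→ℚ (n Data.Nat.* n))
  ⊎ Σ (Subset n) (λ S → abs (ℕ→ℚ ∣ S ∣ - ½ * ℕ→ℚ n) < γ * ℕ→ℚ n
                    × ℕ→ℚ (e₂In G S) < γ * ℕ→ℚ (n Data.Nat.* n))

Splittable : {n : ℕ} → ℚ → StdMultigraph n → Set
Splittable {n} γ G =
  Σ (Subset n) λ U₁ → Σ (Subset n) λ U₂ →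
    Disjoint U₁ U₂
    × (½ - γ) * ℕ→ℚ n ≤ ℕ→ℚ ∣ U₁ ∣
    × (½ - γ) * ℕ→ℚ n ≤ ℕ→ℚ ∣ U₂ ∣
    × ℕ→ℚ (e₂Between G U₁ U₂) ≤ γ * ℕ→ℚ (n Data.Nat.* n)

Heavy Light : {n : ℕ} → StdMultigraph n → Fin n → Fin n → Set
Heavy G x y = μ G x y ≡ 2
Light G x y = μ G x y ≡ 1

-- {a,b,c} spans a copy of an element of K̄₃: all pairs heavy except at most one light pair
IsK̄₃Copy : {n : ℕ} → StdMultigraph n → Fin n → Fin n → Fin n → Set
IsK̄₃Copy G a b c =
    (Heavy G a b × Heavy G a c × Heavy G b c)
  ⊎ (Light G a b × Heavy G a c × Heavy G b c)
  ⊎ (Heavy G a b × Light G a c × Heavy G b c)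
  ⊎ (Heavy G a b × Heavy G a c × Light G b c)

Triple : ℕ → Set
Triple n = Fin n × Fin n × Fin n

LightCrosses : {n : ℕ} → StdMultigraph n → Subset n → Subset n → Fin n → Fin n → Set
LightCrosses G U₁ U₂ x y = Light G x y → (x ∈ U₁ × y ∈ U₂) ⊎ (y ∈ U₁ × x ∈ U₂)

InUnion : {n : ℕ} → Subset n → Subset n → Fin n → Set
InUnion U₁ U₂ x = x ∈ U₁ ⊎ x ∈ U₂

-- A triple, written in increasing order a < b < c (so each vertex set is
-- represented exactly once), which is a copy of an element of K̄₃ in G[U₁ ∪ U₂]
-- meeting both U₁ and U₂, whose light edge (if any) goes between U₁ and U₂.
GoodTriple : {n : ℕ} → StdMultigraph n → Subset n → Subset n → Triple n → Set
GoodTriple G U₁ U₂ (a , b , c) =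
    toℕ a <ℕ toℕ b × toℕ b <ℕ toℕ c
  × InUnion U₁ U₂ a × InUnion U₁ U₂ b × InUnion U₁ U₂ c
  × IsK̄₃Copy G a b c
  × (a ∈ U₁ ⊎ b ∈ U₁ ⊎ c ∈ U₁)
  × (a ∈ U₂ ⊎ b ∈ U₂ ⊎ c ∈ U₂)
  × LightCrosses G U₁ U₂ a b × LightCrosses G U₁ U₂ a c × LightCrosses G U₁ U₂ b c

module Submission where

-- Write γ = p / q; with Γ = p n every hypothesis becomes an inequality between naturals.
-- Non-extremality (with S = U₂) gives at least γ n² heavy edges inside U₂, so U₂ has many
-- vertices with at least γ n / 2 heavy neighbours in U₂ ("rich"), and non-splittability gives
-- more than γ n² heavy edges between U₁ and U₂.  Call such a cross edge x y good if x is rich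
-- in U₁ or y is rich in U₂; since a poor x ∈ U₁ sends many heavy edges to rich vertices of U₂,
-- there are at least (17/600) γ² n² good pairs.  For a good pair the minimum degree leaves at
-- least γ n / 25 vertices z heavy to one end and adjacent to the other, and each such z
-- completes x y to a copy of an element of K̄₃ whose light edge, if any, crosses from U₁ to
-- U₂.  A copy arises from at most six such (x, y, z), which gives γ³ n³ / 6000 copies.

module Sums where

  open import Data.Nat.Base using (ℕ; suc; _+_; _*_; _≤_; z≤n)
  open import Data.Nat.Properties
  open import Data.Bool.Base using (Bool; true; false)
  open import Data.List.Base using (List; []; _∷_; map; length; _++_; cartesianProduct; filter)
  open import Data.List.Relation.Unary.All using (All; []; _∷_)
  open import Data.List.Relation.Unary.Any using (Any; here; there)
  open import Data.Nat.ListAction using (sum)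
  open import Data.Product.Base using (_×_; _,_)
  open import Relation.Nullary.Decidable using (does)
  open import Relation.Unary using (Pred; Decidable)
  open import Relation.Binary.PropositionalEquality
  open import Algebra.Properties.CommutativeSemigroup +-commutativeSemigroup using () renaming (interchange to +-interchange)

  𝟙 : Bool → ℕ
  𝟙 true  = 1
  𝟙 false = 0

  ∑ : {A : Set} → List A → (A → ℕ) → ℕ
  ∑ xs f = sum (map f xs)

  module _ {A : Set} where

    ∑-mono-≤ : ∀ {f g : A → ℕ} xs → (∀ x → f x ≤ g x) → ∑ xs f ≤ ∑ xs g
    ∑-mono-≤ []       f≤g = z≤n
    ∑-mono-≤ (x ∷ xs) f≤g = +-mono-≤ (f≤g x) (∑-mono-≤ xs f≤g)

    ∑-cong : ∀ {f g : A → ℕ} xs → (∀ x → f x ≡ g x) → ∑ xs f ≡ ∑ xs g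
    ∑-cong []       f≡g = refl
    ∑-cong (x ∷ xs) f≡g = cong₂ _+_ (f≡g x) (∑-cong xs f≡g)

    ∑-distrib-+ : ∀ (f g : A → ℕ) xs → ∑ xs (λ x → f x + g x) ≡ ∑ xs f + ∑ xs g
    ∑-distrib-+ f g []       = refl
    ∑-distrib-+ f g (x ∷ xs) =
      trans (cong (f x + g x +_) (∑-distrib-+ f g xs)) (+-interchange (f x) (g x) (∑ xs f) (∑ xs g))

    ∑-distribˡ-* : ∀ c (f : A → ℕ) xs → ∑ xs (λ x → c * f x) ≡ c * ∑ xs f
    ∑-distribˡ-* c f []       = sym (*-zeroʳ c)
    ∑-distribˡ-* c f (x ∷ xs) = trans (cong (c * f x +_) (∑-distribˡ-* c f xs)) (sym (*-distribˡ-+ c (f x) _))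

    ∑-const : ∀ c (xs : List A) → ∑ xs (λ _ → c) ≡ length xs * c
    ∑-const c []       = refl
    ∑-const c (x ∷ xs) = cong (c +_) (∑-const c xs)

    ∑-++ : ∀ (f : A → ℕ) xs ys → ∑ (xs ++ ys) f ≡ ∑ xs f + ∑ ys f
    ∑-++ f []       ys = refl
    ∑-++ f (x ∷ xs) ys = trans (cong (f x +_) (∑-++ f xs ys)) (sym (+-assoc (f x) _ _))

    ∑-≡-const : ∀ {c} {f : A → ℕ} {xs} → All (λ x → f x ≡ c) xs → ∑ xs f ≡ length xs * c
    ∑-≡-const []         = refl
    ∑-≡-const (fx≡c ∷ p) = cong₂ _+_ fx≡c (∑-≡-const p)

    ≤-∑-Any : ∀ {a} {f : A → ℕ} {xs} → Any (λ x → a ≤ f x) xs → a ≤ ∑ xs f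
    ≤-∑-Any (here a≤fx) = ≤-trans a≤fx (m≤m+n _ _)
    ≤-∑-Any (there p)   = ≤-trans (≤-∑-Any p) (m≤n+m _ _)

    length-filter≡∑ : ∀ {p} {P : Pred A p} (P? : Decidable P) xs → length (filter P? xs) ≡ ∑ xs (λ x → 𝟙 (does (P? x)))
    length-filter≡∑ P? []       = refl
    length-filter≡∑ P? (x ∷ xs) with does (P? x)
    ... | true  = cong suc (length-filter≡∑ P? xs)
    ... | false = length-filter≡∑ P? xs

  ∑-map : ∀ {A B : Set} (f : B → ℕ) (g : A → B) xs → ∑ (map g xs) f ≡ ∑ xs (λ x → f (g x))
  ∑-map f g []       = refl
  ∑-map f g (x ∷ xs) = cong (f (g x) +_) (∑-map f g xs)

  ∑-comm : ∀ {A B : Set} (f : A → B → ℕ) xs ys → ∑ xs (λ x → ∑ ys (f x)) ≡ ∑ ys (λ y → ∑ xs (λ x → f x y))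
  ∑-comm f []       ys = sym (trans (∑-const 0 ys) (*-zeroʳ (length ys)))
  ∑-comm f (x ∷ xs) ys = trans (cong (∑ ys (f x) +_) (∑-comm f xs ys)) (sym (∑-distrib-+ (f x) _ ys))

  ∑-cartesianProduct : ∀ {A B : Set} (f : A × B → ℕ) xs ys →
                       ∑ (cartesianProduct xs ys) f ≡ ∑ xs (λ x → ∑ ys (λ y → f (x , y)))
  ∑-cartesianProduct f []       ys = refl
  ∑-cartesianProduct f (x ∷ xs) ys =
    trans (∑-++ f (map (x ,_) ys) _) (cong₂ _+_ (∑-map f (x ,_) ys) (∑-cartesianProduct f xs ys))

module ℕ→ℚ-Properties where

  open import Defs using (ℕ→ℚ)
  open import Data.Nat.Base as ℕ using (ℕ)
  import Data.Nat.Properties as ℕ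
  import Data.Nat.Coprimality as Coprimality
  open import Data.Integer.Base as ℤ using (+_)
  import Data.Integer.Properties as ℤ
  open import Data.Rational.Base
  open import Data.Rational.Properties
  import Data.Rational.Unnormalised.Base as ℚᵘ
  import Data.Rational.Unnormalised.Properties as ℚᵘ
  open import Relation.Binary.PropositionalEquality
  open import Data.Rational.Solver using (module +-*-Solver)
  open +-*-Solver using (solve; _:+_; _:-_; _:=_)

  ℕ→ℚ≡mkℚ : ∀ n → ℕ→ℚ n ≡ mkℚ (+ n) 0 (Coprimality.sym (Coprimality.1-coprimeTo n))
  ℕ→ℚ≡mkℚ n = normalize-coprime _

  toℚᵘ-ℕ→ℚ : ∀ n → toℚᵘ (ℕ→ℚ n) ≡ ℚᵘ.mkℚᵘ (+ n) 0
  toℚᵘ-ℕ→ℚ n = cong toℚᵘ (ℕ→ℚ≡mkℚ n)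

  ℕ→ℚ-homo-+ : ∀ a b → ℕ→ℚ (a ℕ.+ b) ≡ ℕ→ℚ a + ℕ→ℚ b
  ℕ→ℚ-homo-+ a b = toℚᵘ-injective (begin-equality
    toℚᵘ (ℕ→ℚ (a ℕ.+ b))                     ≡⟨ toℚᵘ-ℕ→ℚ (a ℕ.+ b) ⟩
    ℚᵘ.mkℚᵘ (+ (a ℕ.+ b)) 0                  ≃⟨ ℚᵘ.*≡* (cong (ℤ._* + 1) (trans (ℤ.pos-+ a b) (sym (cong₂ ℤ._+_ (ℤ.*-identityʳ (+ a)) (ℤ.*-identityʳ (+ b)))))) ⟩
    ℚᵘ.mkℚᵘ (+ a) 0 ℚᵘ.+ ℚᵘ.mkℚᵘ (+ b) 0    ≡⟨ cong₂ ℚᵘ._+_ (toℚᵘ-ℕ→ℚ a) (toℚᵘ-ℕ→ℚ b) ⟨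
    toℚᵘ (ℕ→ℚ a) ℚᵘ.+ toℚᵘ (ℕ→ℚ b)           ≃⟨ toℚᵘ-homo-+ (ℕ→ℚ a) (ℕ→ℚ b) ⟨
    toℚᵘ (ℕ→ℚ a + ℕ→ℚ b)                     ∎)
    where open ℚᵘ.≤-Reasoning

  ℕ→ℚ-homo-* : ∀ a b → ℕ→ℚ (a ℕ.* b) ≡ ℕ→ℚ a * ℕ→ℚ b
  ℕ→ℚ-homo-* a b = toℚᵘ-injective (begin-equality
    toℚᵘ (ℕ→ℚ (a ℕ.* b))                     ≡⟨ toℚᵘ-ℕ→ℚ (a ℕ.* b) ⟩
    ℚᵘ.mkℚᵘ (+ (a ℕ.* b)) 0                  ≃⟨ ℚᵘ.*≡* (cong (ℤ._* + 1) (ℤ.pos-* a b)) ⟩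
    ℚᵘ.mkℚᵘ (+ a) 0 ℚᵘ.* ℚᵘ.mkℚᵘ (+ b) 0    ≡⟨ cong₂ ℚᵘ._*_ (toℚᵘ-ℕ→ℚ a) (toℚᵘ-ℕ→ℚ b) ⟨
    toℚᵘ (ℕ→ℚ a) ℚᵘ.* toℚᵘ (ℕ→ℚ b)           ≃⟨ toℚᵘ-homo-* (ℕ→ℚ a) (ℕ→ℚ b) ⟨
    toℚᵘ (ℕ→ℚ a * ℕ→ℚ b)                     ∎)
    where open ℚᵘ.≤-Reasoning

  ℕ→ℚ-mono-≤ : ∀ {a b} → a ℕ.≤ b → ℕ→ℚ a ≤ ℕ→ℚ b
  ℕ→ℚ-mono-≤ {a} {b} a≤b rewrite ℕ→ℚ≡mkℚ a | ℕ→ℚ≡mkℚ b =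
    *≤* (subst₂ ℤ._≤_ (sym (ℤ.*-identityʳ (+ a))) (sym (ℤ.*-identityʳ (+ b))) (ℤ.+≤+ a≤b))

  ℕ→ℚ-cancel-≤ : ∀ {a b} → ℕ→ℚ a ≤ ℕ→ℚ b → a ℕ.≤ b
  ℕ→ℚ-cancel-≤ {a} {b} le rewrite ℕ→ℚ≡mkℚ a | ℕ→ℚ≡mkℚ b with le
  ... | *≤* a≤b = ℤ.drop‿+≤+ (subst₂ ℤ._≤_ (ℤ.*-identityʳ (+ a)) (ℤ.*-identityʳ (+ b)) a≤b)

  ℕ→ℚ-mono-< : ∀ {a b} → a ℕ.< b → ℕ→ℚ a < ℕ→ℚ b
  ℕ→ℚ-mono-< {a} {b} a<b rewrite ℕ→ℚ≡mkℚ a | ℕ→ℚ≡mkℚ b =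
    *<* (subst₂ ℤ._<_ (sym (ℤ.*-identityʳ (+ a))) (sym (ℤ.*-identityʳ (+ b))) (ℤ.+<+ a<b))

  ℕ→ℚ-nonNegative : ∀ k → NonNegative (ℕ→ℚ k)
  ℕ→ℚ-nonNegative k = nonNegative (ℕ→ℚ-mono-≤ {0} {k} ℕ.z≤n)

  ℕ→ℚ-positive : ∀ k → .{{ℕ.NonZero k}} → Positive (ℕ→ℚ k)
  ℕ→ℚ-positive k = positive (ℕ→ℚ-mono-< {0} {k} (ℕ.>-nonZero⁻¹ k))

  module ClearDenominators (k : ℕ) .{{_ : ℕ.NonZero k}} (a b c : ℕ) {E F : ℚ}
    (kE≡a-b : ℕ→ℚ k * E ≡ ℕ→ℚ a - ℕ→ℚ b) (kF≡c : ℕ→ℚ k * F ≡ ℕ→ℚ c) where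

    private
      K = ℕ→ℚ k
      A = ℕ→ℚ a
      B = ℕ→ℚ b
      C = ℕ→ℚ c

      A≡A-B+B : A ≡ (A - B) + B
      A≡A-B+B = solve 2 (λ A B → A := (A :- B) :+ B) refl A B

      C≡C+B-B : C ≡ (C + B) - B
      C≡C+B-B = solve 2 (λ C B → C := (C :+ B) :- B) refl C B

    ≤⇒ℕ-≤ : E ≤ F → a ℕ.≤ c ℕ.+ b
    ≤⇒ℕ-≤ E≤F = ℕ→ℚ-cancel-≤ (begin
      A              ≡⟨ A≡A-B+B ⟩
      (A - B) + B    ≡⟨ cong (_+ B) kE≡a-b ⟨
      K * E + B      ≤⟨ +-monoˡ-≤ B (*-monoˡ-≤-nonNeg K {{ℕ→ℚ-nonNegative k}} E≤F) ⟩
      K * F + B      ≡⟨ cong (_+ B) kF≡c ⟩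
      C + B          ≡⟨ ℕ→ℚ-homo-+ c b ⟨
      ℕ→ℚ (c ℕ.+ b)  ∎)
      where open ≤-Reasoning

    ℕ-≤⇒≤ : a ℕ.≤ c ℕ.+ b → E ≤ F
    ℕ-≤⇒≤ a≤c+b = *-cancelˡ-≤-pos K {{ℕ→ℚ-positive k}} (begin
      K * E              ≡⟨ kE≡a-b ⟩
      A - B              ≤⟨ +-monoˡ-≤ (- B) (subst (A ≤_) (ℕ→ℚ-homo-+ c b) (ℕ→ℚ-mono-≤ a≤c+b)) ⟩
      (C + B) - B        ≡⟨ C≡C+B-B ⟨
      C                  ≡⟨ kF≡c ⟨
      K * F              ∎)
      where open ≤-Reasoning

    ℕ-<⇒< : a ℕ.< c ℕ.+ b → E < F
    ℕ-<⇒< a<c+b = *-cancelˡ-<-nonNeg K {{ℕ→ℚ-nonNegative k}} (begin-strict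
      K * E              ≡⟨ kE≡a-b ⟩
      A - B              <⟨ +-monoˡ-< (- B) (subst (A <_) (ℕ→ℚ-homo-+ c b) (ℕ→ℚ-mono-< a<c+b)) ⟩
      (C + B) - B        ≡⟨ C≡C+B-B ⟨
      C                  ≡⟨ kF≡c ⟨
      K * F              ∎)
      where open ≤-Reasoning

module Inequalities where

  open import Data.Nat.Base
  open import Data.Nat.Properties
  open import Data.List.Base using ([]; _∷_)
  open import Relation.Binary.PropositionalEquality
  open import Relation.Nullary.Decidable using (yes; no)
  open import Data.Nat.Tactic.RingSolver using (solve)
  open ≤-Reasoning

  outside-bound : ∀ q Γ c₁ c₂ o → 5 * q * (c₁ + c₂ + o) ≤ 10 * q * c₁ + 2 * Γ →
                  5 * q * (c₁ + c₂ + o) ≤ 10 * q * c₂ + 2 * Γ → 10 * q * o ≤ 4 * Γ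
  outside-bound q Γ c₁ c₂ o h₁ h₂ = +-cancelʳ-≤ _ _ _ (begin
    10 * q * o + (10 * q * c₁ + 10 * q * c₂)        ≡⟨ solve (q ∷ c₁ ∷ c₂ ∷ o ∷ []) ⟩
    5 * q * (c₁ + c₂ + o) + 5 * q * (c₁ + c₂ + o)   ≤⟨ +-mono-≤ h₁ h₂ ⟩
    10 * q * c₁ + 2 * Γ + (10 * q * c₂ + 2 * Γ)     ≡⟨ solve (q ∷ c₁ ∷ c₂ ∷ Γ ∷ []) ⟩
    4 * Γ + (10 * q * c₁ + 10 * q * c₂)             ∎)

  complement-bound : ∀ q Γ c₁ c₂ o → 5 * q * (c₁ + c₂ + o) ≤ 10 * q * c₁ + 2 * Γ →
                     10 * q * c₂ ≤ 5 * q * (c₁ + c₂ + o) + 2 * Γ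
  complement-bound q Γ c₁ c₂ o h = +-cancelʳ-≤ _ _ _ (begin
    10 * q * c₂ + 5 * q * c₁                    ≤⟨ m≤m+n _ (10 * q * o) ⟩
    10 * q * c₂ + 5 * q * c₁ + 10 * q * o       ≡⟨ solve (q ∷ c₁ ∷ c₂ ∷ o ∷ []) ⟩
    5 * q * (c₁ + c₂ + o) + 5 * q * (c₂ + o)    ≤⟨ +-monoˡ-≤ _ h ⟩
    10 * q * c₁ + 2 * Γ + 5 * q * (c₂ + o)      ≡⟨ solve (q ∷ c₁ ∷ c₂ ∷ o ∷ Γ ∷ []) ⟩
    5 * q * (c₁ + c₂ + o) + 2 * Γ + 5 * q * c₁  ∎)

  completion-bound : ∀ q n Γ dx dy h g o → 150 * q * n ≤ 100 * q * dx + Γ → 150 * q * n ≤ 100 * q * dy + Γ →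
                     Γ ≤ 2 * q * h → 10 * q * o ≤ 4 * Γ → dx + dy + h ≤ 3 * n + 2 * g + o → Γ ≤ 25 * q * g
  completion-bound q n Γ dx dy h g o hx hy rich ho pair = *-cancelˡ-≤ 8 (+-cancelʳ-≤ _ _ _ (begin
    8 * Γ + (300 * q * n + 42 * Γ + 100 * q * (dx + dy + h) + 100 * q * o)
      ≡⟨ solve (q ∷ n ∷ Γ ∷ dx ∷ dy ∷ h ∷ o ∷ []) ⟩
    150 * q * n + 150 * q * n + 50 * Γ + 100 * q * (dx + dy + h) + 10 * (10 * q * o)
      ≤⟨ +-mono-≤ (+-mono-≤ (+-mono-≤ (+-mono-≤ hx hy) (*-monoʳ-≤ 50 rich)) (*-monoʳ-≤ (100 * q) pair)) (*-monoʳ-≤ 10 ho) ⟩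
    100 * q * dx + Γ + (100 * q * dy + Γ) + 50 * (2 * q * h) + 100 * q * (3 * n + 2 * g + o) + 10 * (4 * Γ)
      ≡⟨ solve (q ∷ n ∷ Γ ∷ dx ∷ dy ∷ h ∷ g ∷ o ∷ []) ⟩
    8 * (25 * q * g) + (300 * q * n + 42 * Γ + 100 * q * (dx + dy + h) + 100 * q * o) ∎))

  poor-heavyDeg-bound : ∀ q n Γ dx ha h₁ h₂ o → 150 * q * n ≤ 100 * q * dx + Γ → dx ≤ n + ha → ha ≤ h₁ + h₂ + o →
                        2 * q * h₁ ≤ Γ → 10 * q * o ≤ 4 * Γ → 50 * q * n ≤ 100 * q * h₂ + 91 * Γ
  poor-heavyDeg-bound q n Γ dx ha h₁ h₂ o hx hd hsplit poor ho = +-cancelʳ-≤ _ _ _ (begin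
    50 * q * n + (100 * q * n + 100 * q * dx + 100 * q * ha + 100 * q * h₁ + 100 * q * o)
      ≡⟨ solve (q ∷ n ∷ dx ∷ ha ∷ h₁ ∷ o ∷ []) ⟩
    150 * q * n + 100 * q * dx + 100 * q * ha + 50 * (2 * q * h₁) + 10 * (10 * q * o)
      ≤⟨ +-mono-≤ (+-mono-≤ (+-mono-≤ (+-mono-≤ hx (*-monoʳ-≤ (100 * q) hd)) (*-monoʳ-≤ (100 * q) hsplit)) (*-monoʳ-≤ 50 poor)) (*-monoʳ-≤ 10 ho) ⟩
    100 * q * dx + Γ + 100 * q * (n + ha) + 100 * q * (h₁ + h₂ + o) + 50 * Γ + 10 * (4 * Γ)
      ≡⟨ solve (q ∷ n ∷ Γ ∷ dx ∷ ha ∷ h₁ ∷ h₂ ∷ o ∷ []) ⟩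
    100 * q * h₂ + 91 * Γ + (100 * q * n + 100 * q * dx + 100 * q * ha + 100 * q * h₁ + 100 * q * o) ∎)

  poor-richNeighbours-bound : ∀ q n Γ h₂ r hR c₂ → h₂ + r ≤ hR + c₂ → 50 * q * n ≤ 100 * q * h₂ + 91 * Γ →
                              7 * Γ ≤ 6 * q * r → 10 * q * c₂ ≤ 5 * q * n + 2 * Γ → 17 * Γ ≤ 300 * q * hR
  poor-richNeighbours-bound q n Γ h₂ r hR c₂ hi hh hr hc = +-cancelʳ-≤ _ _ _ (begin
    17 * Γ + (300 * q * h₂ + 300 * q * r + 150 * q * n + 333 * Γ + 300 * q * c₂)
      ≡⟨ solve (q ∷ n ∷ Γ ∷ h₂ ∷ r ∷ c₂ ∷ []) ⟩
    300 * q * (h₂ + r) + 3 * (50 * q * n) + 50 * (7 * Γ) + 30 * (10 * q * c₂)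
      ≤⟨ +-mono-≤ (+-mono-≤ (+-mono-≤ (*-monoʳ-≤ (300 * q) hi) (*-monoʳ-≤ 3 hh)) (*-monoʳ-≤ 50 hr)) (*-monoʳ-≤ 30 hc) ⟩
    300 * q * (hR + c₂) + 3 * (100 * q * h₂ + 91 * Γ) + 50 * (6 * q * r) + 30 * (5 * q * n + 2 * Γ)
      ≡⟨ solve (q ∷ n ∷ Γ ∷ h₂ ∷ r ∷ hR ∷ c₂ ∷ []) ⟩
    300 * q * hR + (300 * q * h₂ + 300 * q * r + 150 * q * n + 333 * Γ + 300 * q * c₂) ∎)

  rich-count-bound : ∀ q n Γ e s c₂ r → .{{NonZero q}} → .{{NonZero n}} → Γ * n ≤ q * e → e ≤ s →
                     2 * q * s ≤ 2 * q * c₂ * r + Γ * c₂ → 10 * q * c₂ ≤ 5 * q * n + 2 * Γ → 2 * Γ ≤ q * n →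
                     7 * Γ ≤ 6 * q * r
  rich-count-bound q n Γ e s c₂ r he hes hs hc hΓ =
    *-cancelˡ-≤ 2 (+-cancelʳ-≤ (12 * Γ) (2 * (7 * Γ)) (2 * (6 * q * r)) (begin
      2 * (7 * Γ) + 12 * Γ            ≡⟨ solve (Γ ∷ []) ⟩
      20 * Γ + 6 * Γ                  ≤⟨ +-monoˡ-≤ (6 * Γ) (*-cancelˡ-≤ (q * n) {{m*n≢0 q n}} scaled) ⟩
      12 * q * r + 6 * Γ + 6 * Γ      ≡⟨ solve (q ∷ r ∷ Γ ∷ []) ⟩
      2 * (6 * q * r) + 12 * Γ        ∎))
    where
    scaled : (q * n) * (20 * Γ) ≤ (q * n) * (12 * q * r + 6 * Γ)
    scaled = begin
      (q * n) * (20 * Γ)                     ≡⟨ solve (q ∷ n ∷ Γ ∷ []) ⟩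
      20 * q * (Γ * n)                       ≤⟨ *-monoʳ-≤ (20 * q) he ⟩
      20 * q * (q * e)                       ≡⟨ solve (q ∷ e ∷ []) ⟩
      20 * q * q * e                         ≤⟨ *-monoʳ-≤ (20 * q * q) hes ⟩
      20 * q * q * s                         ≡⟨ solve (q ∷ s ∷ []) ⟩
      (10 * q) * (2 * q * s)                 ≤⟨ *-monoʳ-≤ (10 * q) hs ⟩
      (10 * q) * (2 * q * c₂ * r + Γ * c₂)   ≡⟨ solve (q ∷ c₂ ∷ r ∷ Γ ∷ []) ⟩
      (10 * q * c₂) * (2 * q * r + Γ)        ≤⟨ *-monoˡ-≤ (2 * q * r + Γ) hc ⟩
      (5 * q * n + 2 * Γ) * (2 * q * r + Γ)  ≤⟨ *-monoˡ-≤ (2 * q * r + Γ) (+-monoʳ-≤ (5 * q * n) hΓ) ⟩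
      (5 * q * n + q * n) * (2 * q * r + Γ)  ≡⟨ solve (q ∷ n ∷ r ∷ Γ ∷ []) ⟩
      (q * n) * (12 * q * r + 6 * Γ)         ∎

  good-pairs-bound : ∀ q n Γ P m e → e ≤ P + n * m → Γ * n ≤ q * e → 17 * Γ * m ≤ 300 * q * P → 2 * Γ ≤ q * n →
                     17 * Γ * Γ ≤ 600 * q * q * P
  good-pairs-bound q n Γ P m e he hΓe hm hΓ with Γ ≤? 2 * q * m
  ... | yes Γ≤2qm = begin
    17 * Γ * Γ              ≤⟨ *-monoʳ-≤ (17 * Γ) Γ≤2qm ⟩
    17 * Γ * (2 * q * m)    ≡⟨ solve (Γ ∷ q ∷ m ∷ []) ⟩
    2 * q * (17 * Γ * m)    ≤⟨ *-monoʳ-≤ (2 * q) hm ⟩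
    2 * q * (300 * q * P)   ≡⟨ solve (q ∷ P ∷ []) ⟩
    600 * q * q * P         ∎
  ... | no Γ≰2qm = begin
    17 * Γ * Γ              ≤⟨ *-monoˡ-≤ Γ 17Γ≤300qn ⟩
    300 * q * n * Γ         ≡⟨ solve (q ∷ n ∷ Γ ∷ []) ⟩
    300 * q * (Γ * n)       ≤⟨ *-monoʳ-≤ (300 * q) Γn≤2qP ⟩
    300 * q * (2 * q * P)   ≡⟨ solve (q ∷ P ∷ []) ⟩
    600 * q * q * P         ∎
    where
    17Γ≤300qn : 17 * Γ ≤ 300 * q * n
    17Γ≤300qn = begin
      17 * Γ        ≤⟨ *-monoˡ-≤ Γ (≤ᵇ⇒≤ 17 18 _) ⟩
      18 * Γ        ≡⟨ *-assoc 9 2 Γ ⟩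
      9 * (2 * Γ)   ≤⟨ *-monoʳ-≤ 9 hΓ ⟩
      9 * (q * n)   ≤⟨ *-monoˡ-≤ (q * n) (≤ᵇ⇒≤ 9 300 _) ⟩
      300 * (q * n) ≡⟨ *-assoc 300 q n ⟨
      300 * q * n   ∎
    Γn≤2qP : Γ * n ≤ 2 * q * P
    Γn≤2qP = +-cancelʳ-≤ (Γ * n) (Γ * n) (2 * q * P) (begin
      Γ * n + Γ * n             ≡⟨ solve (Γ ∷ n ∷ []) ⟩
      2 * (Γ * n)               ≤⟨ *-monoʳ-≤ 2 (≤-trans hΓe (*-monoʳ-≤ q he)) ⟩
      2 * (q * (P + n * m))     ≡⟨ solve (q ∷ P ∷ n ∷ m ∷ []) ⟩
      2 * q * P + n * (2 * q * m) ≤⟨ +-monoʳ-≤ (2 * q * P) (*-monoʳ-≤ n (<⇒≤ (≰⇒> Γ≰2qm))) ⟩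
      2 * q * P + n * Γ         ≡⟨ cong (2 * q * P +_) (*-comm n Γ) ⟩
      2 * q * P + Γ * n         ∎)

  good-triples-bound : ∀ q Γ P W S → 17 * Γ * Γ ≤ 600 * q * q * P → Γ * P ≤ 25 * q * W → W ≤ 6 * S →
                       Γ * Γ * Γ ≤ 6000 * (q * q * q * S)
  good-triples-bound q Γ P W S hP hW hS = *-cancelˡ-≤ 17 (begin
    17 * (Γ * Γ * Γ)                ≤⟨ chain 600 25 6 hP hW hS ⟩
    600 * 25 * 6 * (q * q * q * S)  ≤⟨ *-monoˡ-≤ (q * q * q * S) (≤ᵇ⇒≤ 90000 102000 _) ⟩
    102000 * (q * q * q * S)        ≡⟨ *-assoc 17 6000 (q * q * q * S) ⟩
    17 * (6000 * (q * q * q * S))   ∎)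
    where
    chain : ∀ a b c → 17 * Γ * Γ ≤ a * q * q * P → Γ * P ≤ b * q * W → W ≤ c * S →
            17 * (Γ * Γ * Γ) ≤ a * b * c * (q * q * q * S)
    chain a b c hP hW hS = begin
      17 * (Γ * Γ * Γ)            ≡⟨ solve (Γ ∷ []) ⟩
      Γ * (17 * Γ * Γ)            ≤⟨ *-monoʳ-≤ Γ hP ⟩
      Γ * (a * q * q * P)         ≡⟨ solve (Γ ∷ a ∷ q ∷ P ∷ []) ⟩
      a * q * q * (Γ * P)         ≤⟨ *-monoʳ-≤ (a * q * q) hW ⟩
      a * q * q * (b * q * W)     ≡⟨ solve (a ∷ b ∷ q ∷ W ∷ []) ⟩
      a * b * (q * q * q) * W     ≤⟨ *-monoʳ-≤ (a * b * (q * q * q)) hS ⟩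
      a * b * (q * q * q) * (c * S) ≡⟨ solve (a ∷ b ∷ c ∷ q ∷ S ∷ []) ⟩
      a * b * c * (q * q * q * S) ∎

  near-half-above : ∀ q n Γ c → 10 * q * c ≤ 5 * q * n + 2 * Γ → 1 ≤ Γ → 2 * q * c < q * n + 2 * Γ
  near-half-above q n Γ c h 1≤Γ = *-cancelˡ-≤ 5 (begin
    5 * suc (2 * q * c)         ≡⟨ solve (q ∷ c ∷ []) ⟩
    10 * q * c + 5              ≤⟨ +-mono-≤ h (≤-trans (≤ᵇ⇒≤ 5 8 _) (*-monoʳ-≤ 8 1≤Γ)) ⟩
    5 * q * n + 2 * Γ + 8 * Γ   ≡⟨ solve (q ∷ n ∷ Γ ∷ []) ⟩
    5 * (q * n + 2 * Γ)         ∎)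

  near-half-below : ∀ q n Γ c → 5 * q * n ≤ 10 * q * c + 2 * Γ → 1 ≤ Γ → q * n < 2 * q * c + 2 * Γ
  near-half-below q n Γ c h 1≤Γ = *-cancelˡ-≤ 5 (begin
    5 * suc (q * n)             ≡⟨ solve (q ∷ n ∷ []) ⟩
    5 * q * n + 5               ≤⟨ +-mono-≤ h (≤-trans (≤ᵇ⇒≤ 5 8 _) (*-monoʳ-≤ 8 1≤Γ)) ⟩
    10 * q * c + 2 * Γ + 8 * Γ  ≡⟨ solve (q ∷ c ∷ Γ ∷ []) ⟩
    5 * (2 * q * c + 2 * Γ)     ∎)

  at-least-half : ∀ q n Γ c → 5 * q * n ≤ 10 * q * c + 2 * Γ → q * n ≤ 2 * q * c + 2 * Γ
  at-least-half q n Γ c h = *-cancelˡ-≤ 5 (begin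
    5 * (q * n)                 ≡⟨ solve (q ∷ n ∷ []) ⟩
    5 * q * n                   ≤⟨ h ⟩
    10 * q * c + 2 * Γ          ≤⟨ +-monoʳ-≤ (10 * q * c) (*-monoˡ-≤ Γ (≤ᵇ⇒≤ 2 10 _)) ⟩
    10 * q * c + 10 * Γ         ≡⟨ solve (q ∷ c ∷ Γ ∷ []) ⟩
    5 * (2 * q * c + 2 * Γ)     ∎)

module GoodTriples where

  open import Defs
  open Sums
  open import Data.Nat.Base using (ℕ; suc; _≤_; _*_; s≤s; z≤n)
  open import Data.Nat.Properties using (≤-reflexive; 1+n≢0; module ≤-Reasoning)
  open import Data.Fin.Base using (Fin; toℕ)
  open import Data.Fin.Properties using (<-cmp)
  open import Data.Fin.Subset using (Subset; _∈_)
  open import Data.Fin.Subset.Properties using (_∈?_)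
  open import Data.List.Base using (List; []; _∷_; length; filter; allFin; cartesianProduct)
  open import Data.List.Relation.Unary.All using (All; []; _∷_)
  open import Data.List.Relation.Unary.Any as Any using (Any; here; there)
  open import Data.List.Relation.Unary.All.Properties using (all-filter)
  open import Data.List.Relation.Unary.Unique.Propositional using (Unique)
  open import Data.List.Relation.Unary.Unique.Propositional.Properties using (filter⁺; cartesianProduct⁺; allFin⁺)
  open import Data.Nat.Properties using (_<?_; _≟_)
  open import Data.Product.Base using (_×_; _,_)
  open import Data.Sum.Base using (_⊎_; inj₁; inj₂; swap)
  open import Data.Bool.Base using (Bool; true; false; T)
  open import Function.Base using (id; _∘_)
  open import Relation.Binary.Definitions using (tri<; tri≈; tri>)
  open import Relation.Binary.PropositionalEquality
  open import Relation.Nullary.Negation using (contradiction)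
  open import Relation.Nullary.Decidable using (Dec; does; dec-true; _×-dec_; _⊎-dec_; _→-dec_)
  open import Relation.Unary using (Decidable)

  ⊎-swap₁₂ : ∀ {A B C : Set} → A ⊎ B ⊎ C → B ⊎ A ⊎ C
  ⊎-swap₁₂ (inj₁ a)        = inj₂ (inj₁ a)
  ⊎-swap₁₂ (inj₂ (inj₁ b)) = inj₁ b
  ⊎-swap₁₂ (inj₂ (inj₂ c)) = inj₂ (inj₂ c)

  ⊎-swap₂₃ : ∀ {A B C : Set} → A ⊎ B ⊎ C → A ⊎ C ⊎ B
  ⊎-swap₂₃ (inj₁ a) = inj₁ a
  ⊎-swap₂₃ (inj₂ bc) = inj₂ (swap bc)

  swap₁₂ swap₂₃ : ∀ {n} → Triple n → Triple n
  swap₁₂ (a , b , c) = b , a , c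
  swap₂₃ (a , b , c) = a , c , b

  permutations : ∀ {n} → List (Triple n → Triple n)
  permutations = id ∷ swap₂₃ ∷ swap₁₂ ∷ swap₁₂ ∘ swap₂₃ ∷ swap₂₃ ∘ swap₁₂ ∷ swap₁₂ ∘ swap₂₃ ∘ swap₁₂ ∷ []

  module _ {n : ℕ} where

    triples : List (Triple n)
    triples = cartesianProduct (allFin n) (cartesianProduct (allFin n) (allFin n))

    ∑-triples : ∀ (f : Triple n → ℕ) → ∑ triples f ≡ Σv λ a → Σv λ b → Σv λ c → f (a , b , c)
    ∑-triples f = trans (∑-cartesianProduct f (allFin n) (cartesianProduct (allFin n) (allFin n)))
      (∑-cong (allFin n) λ a → ∑-cartesianProduct (λ bc → f (a , bc)) (allFin n) (allFin n))

    ∑-triples-swap₁₂ : ∀ (f : Triple n → ℕ) → ∑ triples (f ∘ swap₁₂) ≡ ∑ triples f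
    ∑-triples-swap₁₂ f = trans (∑-triples (f ∘ swap₁₂))
      (trans (∑-comm (λ a b → Σv λ c → f (b , a , c)) (allFin n) (allFin n)) (sym (∑-triples f)))

    ∑-triples-swap₂₃ : ∀ (f : Triple n → ℕ) → ∑ triples (f ∘ swap₂₃) ≡ ∑ triples f
    ∑-triples-swap₂₃ f = trans (∑-triples (f ∘ swap₂₃))
      (trans (∑-cong (allFin n) λ a → ∑-comm (λ b c → f (a , c , b)) (allFin n) (allFin n)) (sym (∑-triples f)))

    ∑-triples-permutations : ∀ (f : Triple n → ℕ) → ∑ triples (λ t → ∑ permutations λ π → f (π t)) ≡ 6 * ∑ triples f
    ∑-triples-permutations f = trans (∑-comm (λ t π → f (π t)) triples permutations) (∑-≡-const {f = λ π → ∑ triples (f ∘ π)}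
      ( refl
      ∷ ∑-triples-swap₂₃ f
      ∷ ∑-triples-swap₁₂ f
      ∷ trans (∑-triples-swap₂₃ (f ∘ swap₁₂)) (∑-triples-swap₁₂ f)
      ∷ trans (∑-triples-swap₁₂ (f ∘ swap₂₃)) (∑-triples-swap₂₃ f)
      ∷ trans (∑-triples-swap₁₂ (f ∘ swap₁₂ ∘ swap₂₃)) (trans (∑-triples-swap₂₃ (f ∘ swap₁₂)) (∑-triples-swap₁₂ f))
      ∷ []))

  module _ {n : ℕ} (G : StdMultigraph n) (U₁ U₂ : Subset n) where

    GoodUnordered : Triple n → Set
    GoodUnordered (a , b , c) =
        InUnion U₁ U₂ a × InUnion U₁ U₂ b × InUnion U₁ U₂ c
      × IsK̄₃Copy G a b c
      × (a ∈ U₁ ⊎ b ∈ U₁ ⊎ c ∈ U₁)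
      × (a ∈ U₂ ⊎ b ∈ U₂ ⊎ c ∈ U₂)
      × LightCrosses G U₁ U₂ a b × LightCrosses G U₁ U₂ a c × LightCrosses G U₁ U₂ b c

    heavy-sym : ∀ {x y} → Heavy G x y → Heavy G y x
    heavy-sym {x} {y} = trans (μ-sym G y x)

    light-sym : ∀ {x y} → Light G x y → Light G y x
    light-sym {x} {y} = trans (μ-sym G y x)

    lightCrosses-sym : ∀ {x y} → LightCrosses G U₁ U₂ x y → LightCrosses G U₁ U₂ y x
    lightCrosses-sym crosses = swap ∘ crosses ∘ light-sym

    K̄₃-swap₁₂ : ∀ {a b c} → IsK̄₃Copy G a b c → IsK̄₃Copy G b a c
    K̄₃-swap₁₂ (inj₁ (ab , ac , bc))               = inj₁ (heavy-sym ab , bc , ac)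
    K̄₃-swap₁₂ (inj₂ (inj₁ (ab , ac , bc)))        = inj₂ (inj₁ (light-sym ab , bc , ac))
    K̄₃-swap₁₂ (inj₂ (inj₂ (inj₁ (ab , ac , bc)))) = inj₂ (inj₂ (inj₂ (heavy-sym ab , bc , ac)))
    K̄₃-swap₁₂ (inj₂ (inj₂ (inj₂ (ab , ac , bc)))) = inj₂ (inj₂ (inj₁ (heavy-sym ab , bc , ac)))

    K̄₃-swap₂₃ : ∀ {a b c} → IsK̄₃Copy G a b c → IsK̄₃Copy G a c b
    K̄₃-swap₂₃ (inj₁ (ab , ac , bc))               = inj₁ (ac , ab , heavy-sym bc)
    K̄₃-swap₂₃ (inj₂ (inj₁ (ab , ac , bc)))        = inj₂ (inj₂ (inj₁ (ac , ab , heavy-sym bc)))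
    K̄₃-swap₂₃ (inj₂ (inj₂ (inj₁ (ab , ac , bc)))) = inj₂ (inj₁ (ac , ab , heavy-sym bc))
    K̄₃-swap₂₃ (inj₂ (inj₂ (inj₂ (ab , ac , bc)))) = inj₂ (inj₂ (inj₂ (ac , ab , light-sym bc)))

    goodUnordered-swap₁₂ : ∀ t → GoodUnordered t → GoodUnordered (swap₁₂ t)
    goodUnordered-swap₁₂ (a , b , c) (ia , ib , ic , k , m₁ , m₂ , ab , ac , bc) =
      ib , ia , ic , K̄₃-swap₁₂ k , ⊎-swap₁₂ m₁ , ⊎-swap₁₂ m₂ , lightCrosses-sym ab , bc , ac

    goodUnordered-swap₂₃ : ∀ t → GoodUnordered t → GoodUnordered (swap₂₃ t)
    goodUnordered-swap₂₃ (a , b , c) (ia , ib , ic , k , m₁ , m₂ , ab , ac , bc) =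
      ia , ic , ib , K̄₃-swap₂₃ k , ⊎-swap₂₃ m₁ , ⊎-swap₂₃ m₂ , ac , ab , lightCrosses-sym bc

    heavy⇒distinct : ∀ {x y} → Heavy G x y → x ≢ y
    heavy⇒distinct {x} xx-heavy refl = 1+n≢0 (trans (sym xx-heavy) (μ-loop G x))

    light⇒distinct : ∀ {x y} → Light G x y → x ≢ y
    light⇒distinct {x} xx-light refl = 1+n≢0 (trans (sym xx-light) (μ-loop G x))

    K̄₃-distinct : ∀ {a b c} → IsK̄₃Copy G a b c → a ≢ b × b ≢ c × a ≢ c
    K̄₃-distinct (inj₁ (ab , ac , bc))               = heavy⇒distinct ab , heavy⇒distinct bc , heavy⇒distinct ac
    K̄₃-distinct (inj₂ (inj₁ (ab , ac , bc)))        = light⇒distinct ab , heavy⇒distinct bc , heavy⇒distinct ac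
    K̄₃-distinct (inj₂ (inj₂ (inj₁ (ab , ac , bc)))) = heavy⇒distinct ab , heavy⇒distinct bc , light⇒distinct ac
    K̄₃-distinct (inj₂ (inj₂ (inj₂ (ab , ac , bc)))) = heavy⇒distinct ab , light⇒distinct bc , heavy⇒distinct ac

    goodUnordered⇒sorted-permutation : ∀ t → GoodUnordered t → Any (λ π → GoodTriple G U₁ U₂ (π t)) permutations
    goodUnordered⇒sorted-permutation t@(x , y , z) g@(_ , _ , _ , k , _)
      with K̄₃-distinct k | <-cmp x y | <-cmp y z | <-cmp x z
    ... | x≢y , _   , _   | tri≈ _ x≡y _ | _ | _ = contradiction x≡y x≢y
    ... | _   , y≢z , _   | _ | tri≈ _ y≡z _ | _ = contradiction y≡z y≢z
    ... | _   , _   , x≢z | _ | _ | tri≈ _ x≡z _ = contradiction x≡z x≢z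
    ... | _ | tri< x<y _ _ | tri< y<z _ _ | _            = here (x<y , y<z , g)
    ... | _ | tri< x<y _ _ | tri> _ _ z<y | tri< x<z _ _ = there (here (x<z , z<y , goodUnordered-swap₂₃ t g))
    ... | _ | tri< x<y _ _ | tri> _ _ z<y | tri> _ _ z<x =
      there (there (there (here (z<x , x<y , goodUnordered-swap₁₂ _ (goodUnordered-swap₂₃ t g)))))
    ... | _ | tri> _ _ y<x | tri< y<z _ _ | tri< x<z _ _ = there (there (here (y<x , x<z , goodUnordered-swap₁₂ t g)))
    ... | _ | tri> _ _ y<x | tri< y<z _ _ | tri> _ _ z<x =
      there (there (there (there (here (y<z , z<x , goodUnordered-swap₂₃ _ (goodUnordered-swap₁₂ t g))))))
    ... | _ | tri> _ _ y<x | tri> _ _ z<y | _            =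
      there (there (there (there (there (here (z<y , y<x ,
        goodUnordered-swap₁₂ _ (goodUnordered-swap₂₃ _ (goodUnordered-swap₁₂ t g))))))))

    light-or-heavy : ∀ x y → 1 ≤ μ G x y → Light G x y ⊎ Heavy G x y
    light-or-heavy x y 1≤μ with μ G x y | μ-≤2 G x y
    ... | 1 | _ = inj₁ refl
    ... | 2 | _ = inj₂ refl
    ... | suc (suc (suc _)) | s≤s (s≤s ())

    heavy-crosses : ∀ {x y} → Heavy G x y → LightCrosses G U₁ U₂ x y
    heavy-crosses xy-heavy xy-light = contradiction (trans (sym xy-heavy) xy-light) λ ()

    heavyEdge+commonNeighbour⇒goodUnordered : ∀ {x y z} → x ∈ U₁ → y ∈ U₂ → Heavy G x y →
      (z ∈ U₁ × Heavy G x z × 1 ≤ μ G y z) ⊎ (z ∈ U₂ × Heavy G y z × 1 ≤ μ G x z) →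
      GoodUnordered (x , y , z)
    heavyEdge+commonNeighbour⇒goodUnordered {x} {y} {z} x∈U₁ y∈U₂ xy (inj₁ (z∈U₁ , xz , 1≤yz)) with light-or-heavy y z 1≤yz
    ... | inj₁ yz = inj₁ x∈U₁ , inj₂ y∈U₂ , inj₁ z∈U₁ , inj₂ (inj₂ (inj₂ (xy , xz , yz))) , inj₁ x∈U₁ , inj₂ (inj₁ y∈U₂)
                  , heavy-crosses xy , heavy-crosses xz , λ _ → inj₂ (z∈U₁ , y∈U₂)
    ... | inj₂ yz = inj₁ x∈U₁ , inj₂ y∈U₂ , inj₁ z∈U₁ , inj₁ (xy , xz , yz) , inj₁ x∈U₁ , inj₂ (inj₁ y∈U₂)
                  , heavy-crosses xy , heavy-crosses xz , heavy-crosses yz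
    heavyEdge+commonNeighbour⇒goodUnordered {x} {y} {z} x∈U₁ y∈U₂ xy (inj₂ (z∈U₂ , yz , 1≤xz)) with light-or-heavy x z 1≤xz
    ... | inj₁ xz = inj₁ x∈U₁ , inj₂ y∈U₂ , inj₂ z∈U₂ , inj₂ (inj₂ (inj₁ (xy , xz , yz))) , inj₁ x∈U₁ , inj₂ (inj₁ y∈U₂)
                  , heavy-crosses xy , (λ _ → inj₁ (x∈U₁ , z∈U₂)) , heavy-crosses yz
    ... | inj₂ xz = inj₁ x∈U₁ , inj₂ y∈U₂ , inj₂ z∈U₂ , inj₁ (xy , xz , yz) , inj₁ x∈U₁ , inj₂ (inj₁ y∈U₂)
                  , heavy-crosses xy , heavy-crosses xz , heavy-crosses yz

    goodUnordered? : Decidable GoodUnordered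
    goodUnordered? (a , b , c) =
      inUnion? a ×-dec inUnion? b ×-dec inUnion? c ×-dec K̄₃? ×-dec
      (a ∈? U₁ ⊎-dec b ∈? U₁ ⊎-dec c ∈? U₁) ×-dec (a ∈? U₂ ⊎-dec b ∈? U₂ ⊎-dec c ∈? U₂) ×-dec
      crosses? a b ×-dec crosses? a c ×-dec crosses? b c
      where
      inUnion? : ∀ x → Dec (InUnion U₁ U₂ x)
      inUnion? x = x ∈? U₁ ⊎-dec x ∈? U₂
      heavy? light? : ∀ x y → Dec (μ G x y ≡ _)
      heavy? x y = μ G x y ≟ 2
      light? x y = μ G x y ≟ 1
      K̄₃? : Dec (IsK̄₃Copy G a b c)
      K̄₃? = (heavy? a b ×-dec heavy? a c ×-dec heavy? b c) ⊎-dec (light? a b ×-dec heavy? a c ×-dec heavy? b c)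
        ⊎-dec (heavy? a b ×-dec light? a c ×-dec heavy? b c) ⊎-dec (heavy? a b ×-dec heavy? a c ×-dec light? b c)
      crosses? : ∀ x y → Dec (LightCrosses G U₁ U₂ x y)
      crosses? x y = light? x y →-dec ((x ∈? U₁ ×-dec y ∈? U₂) ⊎-dec (y ∈? U₁ ×-dec x ∈? U₂))

    goodTriple? : Decidable (GoodTriple G U₁ U₂)
    goodTriple? t@(a , b , c) = toℕ a <? toℕ b ×-dec toℕ b <? toℕ c ×-dec goodUnordered? t

    goodTriples : List (Triple n)
    goodTriples = filter goodTriple? triples

    goodTriples-unique : Unique goodTriples
    goodTriples-unique = filter⁺ goodTriple? (cartesianProduct⁺ (allFin⁺ n) (cartesianProduct⁺ (allFin⁺ n) (allFin⁺ n)))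

    goodTriples-good : All (GoodTriple G U₁ U₂) goodTriples
    goodTriples-good = all-filter goodTriple? triples

    count-goodUnordered≤6*goodTriples : (W : Triple n → Bool) → (∀ t → T (W t) → GoodUnordered t) →
                          ∑ triples (𝟙 ∘ W) ≤ 6 * length goodTriples
    count-goodUnordered≤6*goodTriples W W⇒good = begin
      ∑ triples (𝟙 ∘ W)                                              ≤⟨ ∑-mono-≤ triples at-most-permutations ⟩
      ∑ triples (λ t → ∑ permutations λ π → 𝟙 (does (goodTriple? (π t)))) ≡⟨ ∑-triples-permutations (λ t → 𝟙 (does (goodTriple? t))) ⟩
      6 * ∑ triples (λ t → 𝟙 (does (goodTriple? t)))                 ≡⟨ cong (6 *_) (length-filter≡∑ goodTriple? triples) ⟨
      6 * length goodTriples                                          ∎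
      where
      open ≤-Reasoning
      at-most-permutations : ∀ t → 𝟙 (W t) ≤ ∑ permutations λ π → 𝟙 (does (goodTriple? (π t)))
      at-most-permutations t with W t in Wt≡true
      ... | false = z≤n
      ... | true  = ≤-∑-Any (Any.map (λ {π} good → ≤-reflexive (sym (cong 𝟙 (dec-true (goodTriple? (π t)) good))))
                                     (goodUnordered⇒sorted-permutation t (W⇒good t (subst T (sym Wt≡true) _))))

module Counting where

  open import Defs
  open Sums
  open GoodTriples
  open import Data.Nat.Base
  open import Data.Nat.Properties
  open import Data.Bool.Base using (Bool; true; false; T; _∧_; _∨_; not; if_then_else_)
  open import Data.Bool.Properties using (T-∧; T-∨; T-≡; ∨-identityʳ)
  open import Data.Fin.Base as Fin using (Fin; toℕ)
  open import Data.Fin.Subset using (Subset; ∣_∣; _∈_)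
  open import Data.List.Base using (allFin; length)
  open import Data.Nat.ListAction using (sum)
  open import Data.List.Properties using (length-tabulate; map-tabulate)
  open import Data.Vec.Base using ([]; _∷_; lookup)
  open import Data.Vec.Properties using (lookup⇒[]=)
  open import Data.Product.Base using (_×_; _,_; proj₁)
  open import Data.Empty using (⊥-elim)
  open import Data.Sum.Base as Sum using (_⊎_; inj₁; inj₂)
  open import Function.Base using (id; _∘_)
  open import Function.Bundles using (Equivalence)
  open import Relation.Binary.PropositionalEquality
  open Inequalities

  open Equivalence using (to)

  count : ∀ {n} → (Fin n → Bool) → ℕ
  count P = Σv λ z → 𝟙 (P z)

  module FinSums (n : ℕ) where

    Σv-const : ∀ c → Σv (λ (_ : Fin n) → c) ≡ n * c
    Σv-const c = trans (∑-const c (allFin n)) (cong (_* c) (length-tabulate {n = n} id))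

    Σv-zero : Σv (λ (_ : Fin n) → 0) ≡ 0
    Σv-zero = trans (Σv-const 0) (*-zeroʳ n)

    Σv-one : Σv (λ (_ : Fin n) → 1) ≡ n
    Σv-one = trans (Σv-const 1) (*-identityʳ n)

    count-mono : ∀ {P Q : Fin n → Bool} → (∀ z → T (P z) → T (Q z)) → count P ≤ count Q
    count-mono {P} {Q} P⇒Q = ∑-mono-≤ (allFin n) λ z → 𝟙-mono (P z) (Q z) (P⇒Q z)
      where
      𝟙-mono : ∀ a b → (T a → T b) → 𝟙 a ≤ 𝟙 b
      𝟙-mono false _    _   = z≤n
      𝟙-mono true  true _   = ≤-refl
      𝟙-mono true  false a⇒b = ⊥-elim (a⇒b _)

    Σv-+₃ : ∀ (f g h : Fin n → ℕ) → Σv (λ z → f z + g z + h z) ≡ Σv f + Σv g + Σv h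
    Σv-+₃ f g h = trans (∑-distrib-+ _ h (allFin n)) (cong (_+ Σv h) (∑-distrib-+ f g (allFin n)))

  Σv-suc : ∀ {n} (f : Fin (suc n) → ℕ) → Σv f ≡ f Fin.zero + Σv (f ∘ Fin.suc)
  Σv-suc {n} f = cong (λ zs → f Fin.zero + sum zs) (trans (map-tabulate Fin.suc f) (sym (map-tabulate id (f ∘ Fin.suc))))

  ∣S∣≡count : ∀ {n} (S : Subset n) → ∣ S ∣ ≡ count (lookup S)
  ∣S∣≡count []          = refl
  ∣S∣≡count (true ∷ S)  = trans (cong suc (∣S∣≡count S)) (sym (Σv-suc (𝟙 ∘ lookup (true ∷ S))))
  ∣S∣≡count (false ∷ S) = trans (∣S∣≡count S) (sym (Σv-suc (𝟙 ∘ lookup (false ∷ S))))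

  module Graph {n : ℕ} (G : StdMultigraph n) (U₁ U₂ : Subset n)
               (U₁-disjoint-U₂ : ∀ z → lookup U₁ z ≡ true → lookup U₂ z ≡ false) where

    open FinSums n

    in₁ in₂ outside : Fin n → Bool
    in₁ = lookup U₁
    in₂ = lookup U₂
    outside z = not (in₁ z ∨ in₂ z)

    heavy adjacent : Fin n → Fin n → Bool
    heavy x y    = μ G x y ≡ᵇ 2
    adjacent x y = 1 ≤ᵇ μ G x y

    heavyDeg heavyDeg₁ heavyDeg₂ : Fin n → ℕ
    heavyDeg  x = count (heavy x)
    heavyDeg₁ x = count λ z → in₁ z ∧ heavy x z
    heavyDeg₂ x = count λ z → in₂ z ∧ heavy x z

    completes : Fin n → Fin n → Fin n → Bool
    completes x y z = (in₁ z ∧ heavy x z ∧ adjacent y z) ∨ (in₂ z ∧ heavy y z ∧ adjacent x z)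

    completions : Fin n → Fin n → ℕ
    completions x y = count (completes x y)

    sizes-partition : count in₁ + count in₂ + count outside ≡ n
    sizes-partition = begin
      count in₁ + count in₂ + count outside         ≡⟨ Σv-+₃ (𝟙 ∘ in₁) (𝟙 ∘ in₂) (𝟙 ∘ outside) ⟨
      Σv (λ z → 𝟙 (in₁ z) + 𝟙 (in₂ z) + 𝟙 (outside z)) ≡⟨ ∑-cong (allFin n) (λ z → exactly-one (in₁ z) (in₂ z) (U₁-disjoint-U₂ z)) ⟩
      Σv (λ (_ : Fin n) → 1)                         ≡⟨ Σv-one ⟩
      n                                              ∎
      where
      open ≡-Reasoning
      exactly-one : ∀ u v → (u ≡ true → v ≡ false) → 𝟙 u + 𝟙 v + 𝟙 (not (u ∨ v)) ≡ 1
      exactly-one true  true  u⇒¬v with () ← u⇒¬v refl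
      exactly-one true  false _    = refl
      exactly-one false true  _    = refl
      exactly-one false false _    = refl

    deg≤n+heavyDeg : ∀ x → deg G x ≤ n + heavyDeg x
    deg≤n+heavyDeg x = begin
      deg G x                                ≤⟨ ∑-mono-≤ (allFin n) (λ z → μ≤1+heavy (μ G x z) (μ-≤2 G x z)) ⟩
      Σv (λ z → 1 + 𝟙 (heavy x z))          ≡⟨ ∑-distrib-+ (λ _ → 1) (𝟙 ∘ heavy x) (allFin n) ⟩
      Σv (λ (_ : Fin n) → 1) + heavyDeg x    ≡⟨ cong (_+ heavyDeg x) Σv-one ⟩
      n + heavyDeg x                         ∎
      where
      open ≤-Reasoning
      μ≤1+heavy : ∀ a → a ≤ 2 → a ≤ 1 + 𝟙 (a ≡ᵇ 2)
      μ≤1+heavy 0 _ = z≤n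
      μ≤1+heavy 1 _ = s≤s z≤n
      μ≤1+heavy 2 _ = ≤-refl
      μ≤1+heavy (suc (suc (suc _))) (s≤s (s≤s ()))

    heavyDeg-split : ∀ x → heavyDeg x ≤ heavyDeg₁ x + heavyDeg₂ x + count outside
    heavyDeg-split x = ≤-trans (∑-mono-≤ (allFin n) (λ z → split (in₁ z) (in₂ z) (heavy x z)))
                               (≤-reflexive (Σv-+₃ (λ z → 𝟙 (in₁ z ∧ heavy x z)) (λ z → 𝟙 (in₂ z ∧ heavy x z)) (𝟙 ∘ outside)))
      where
      split : ∀ u v h → 𝟙 h ≤ 𝟙 (u ∧ h) + 𝟙 (v ∧ h) + 𝟙 (not (u ∨ v))
      split true  v     h     = ≤-trans (m≤m+n (𝟙 h) _) (m≤m+n _ _)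
      split false true  h     = ≤-reflexive (sym (+-identityʳ (𝟙 h)))
      split false false false = z≤n
      split false false true  = ≤-refl

    private
      ≤ᵇ-false⇒≥ : ∀ {a b} → (a ≤ᵇ b) ≡ false → b ≤ a
      ≤ᵇ-false⇒≥ a≰b = <⇒≤ (≰⇒> λ a≤b → subst T a≰b (≤⇒≤ᵇ a≤b))

      by-computation : ∀ {m n} {_ : T (m ≤ᵇ n)} → m ≤ n
      by-computation {m} {n} {m≤ᵇn} = ≤ᵇ⇒≤ m n m≤ᵇn

      -- μ x z + μ y z ≤ 4 exceeds 3 only if z is heavy to one end and adjacent to the other.
      pair-weight : ∀ a b → a ≤ 2 → b ≤ 2 → a + b + 𝟙 (a ≡ᵇ 2) ≤ 3 + 2 * 𝟙 ((a ≡ᵇ 2) ∧ (1 ≤ᵇ b))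
      pair-weight 0 0 _ _ = by-computation
      pair-weight 0 1 _ _ = by-computation
      pair-weight 0 2 _ _ = by-computation
      pair-weight 1 0 _ _ = by-computation
      pair-weight 1 1 _ _ = by-computation
      pair-weight 1 2 _ _ = by-computation
      pair-weight 2 0 _ _ = by-computation
      pair-weight 2 1 _ _ = by-computation
      pair-weight 2 2 _ _ = by-computation
      pair-weight (suc (suc (suc _))) _ (s≤s (s≤s ())) _
      pair-weight _ (suc (suc (suc _))) _ (s≤s (s≤s ()))

      pair-weight′ : ∀ a b → a ≤ 2 → b ≤ 2 → a + b ≤ 3 + 2 * 𝟙 ((a ≡ᵇ 2) ∧ (1 ≤ᵇ b))
      pair-weight′ a b a≤2 b≤2 = ≤-trans (m≤m+n (a + b) _) (pair-weight a b a≤2 b≤2)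

      weight-with-heavy₁ : ∀ a b u v → a ≤ 2 → b ≤ 2 → (u ≡ true → v ≡ false) →
        a + b + 𝟙 (u ∧ (a ≡ᵇ 2)) ≤ 3 + 2 * 𝟙 ((u ∧ (a ≡ᵇ 2) ∧ (1 ≤ᵇ b)) ∨ (v ∧ (b ≡ᵇ 2) ∧ (1 ≤ᵇ a))) + 𝟙 (not (u ∨ v))
      weight-with-heavy₁ a b true true _ _ u⇒¬v with () ← u⇒¬v refl
      weight-with-heavy₁ a b true false a≤2 b≤2 _ = begin
        a + b + 𝟙 (a ≡ᵇ 2)                          ≤⟨ pair-weight a b a≤2 b≤2 ⟩
        3 + 2 * 𝟙 ((a ≡ᵇ 2) ∧ (1 ≤ᵇ b))            ≡⟨ cong (λ w → 3 + 2 * 𝟙 w) (∨-identityʳ ((a ≡ᵇ 2) ∧ (1 ≤ᵇ b))) ⟨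
        3 + 2 * 𝟙 (((a ≡ᵇ 2) ∧ (1 ≤ᵇ b)) ∨ false)  ≡⟨ +-identityʳ _ ⟨
        3 + 2 * 𝟙 (((a ≡ᵇ 2) ∧ (1 ≤ᵇ b)) ∨ false) + 0 ∎
        where open ≤-Reasoning
      weight-with-heavy₁ a b false true a≤2 b≤2 _ = begin
        a + b + 0                          ≡⟨ +-identityʳ _ ⟩
        a + b                              ≡⟨ +-comm a b ⟩
        b + a                              ≤⟨ pair-weight′ b a b≤2 a≤2 ⟩
        3 + 2 * 𝟙 ((b ≡ᵇ 2) ∧ (1 ≤ᵇ a))   ≡⟨ +-identityʳ _ ⟨
        3 + 2 * 𝟙 ((b ≡ᵇ 2) ∧ (1 ≤ᵇ a)) + 0 ∎
        where open ≤-Reasoning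
      weight-with-heavy₁ a b false false a≤2 b≤2 _ =
        ≤-trans (≤-reflexive (+-identityʳ _)) (+-mono-≤ a≤2 b≤2)

      weight-with-heavy₂ : ∀ a b u v → a ≤ 2 → b ≤ 2 → (u ≡ true → v ≡ false) →
        a + b + 𝟙 (v ∧ (b ≡ᵇ 2)) ≤ 3 + 2 * 𝟙 ((u ∧ (a ≡ᵇ 2) ∧ (1 ≤ᵇ b)) ∨ (v ∧ (b ≡ᵇ 2) ∧ (1 ≤ᵇ a))) + 𝟙 (not (u ∨ v))
      weight-with-heavy₂ a b true true _ _ u⇒¬v with () ← u⇒¬v refl
      weight-with-heavy₂ a b true false a≤2 b≤2 _ = begin
        a + b + 0                                   ≡⟨ +-identityʳ _ ⟩
        a + b                                       ≤⟨ pair-weight′ a b a≤2 b≤2 ⟩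
        3 + 2 * 𝟙 ((a ≡ᵇ 2) ∧ (1 ≤ᵇ b))            ≡⟨ cong (λ w → 3 + 2 * 𝟙 w) (∨-identityʳ ((a ≡ᵇ 2) ∧ (1 ≤ᵇ b))) ⟨
        3 + 2 * 𝟙 (((a ≡ᵇ 2) ∧ (1 ≤ᵇ b)) ∨ false)  ≡⟨ +-identityʳ _ ⟨
        3 + 2 * 𝟙 (((a ≡ᵇ 2) ∧ (1 ≤ᵇ b)) ∨ false) + 0 ∎
        where open ≤-Reasoning
      weight-with-heavy₂ a b false true a≤2 b≤2 _ = begin
        a + b + 𝟙 (b ≡ᵇ 2)                 ≡⟨ cong (_+ 𝟙 (b ≡ᵇ 2)) (+-comm a b) ⟩
        b + a + 𝟙 (b ≡ᵇ 2)                 ≤⟨ pair-weight b a b≤2 a≤2 ⟩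
        3 + 2 * 𝟙 ((b ≡ᵇ 2) ∧ (1 ≤ᵇ a))   ≡⟨ +-identityʳ _ ⟨
        3 + 2 * 𝟙 ((b ≡ᵇ 2) ∧ (1 ≤ᵇ a)) + 0 ∎
        where open ≤-Reasoning
      weight-with-heavy₂ a b false false a≤2 b≤2 _ =
        ≤-trans (≤-reflexive (+-identityʳ _)) (+-mono-≤ a≤2 b≤2)

    degree-pair : ∀ x y (w : Fin n → Bool) →
                  (∀ z → μ G x z + μ G y z + 𝟙 (w z) ≤ 3 + 2 * 𝟙 (completes x y z) + 𝟙 (outside z)) →
                  deg G x + deg G y + count w ≤ 3 * n + 2 * completions x y + count outside
    degree-pair x y w pointwise = begin
      deg G x + deg G y + count w                                          ≡⟨ Σv-+₃ (μ G x) (μ G y) (𝟙 ∘ w) ⟨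
      Σv (λ z → μ G x z + μ G y z + 𝟙 (w z))                              ≤⟨ ∑-mono-≤ (allFin n) pointwise ⟩
      Σv (λ z → 3 + 2 * 𝟙 (completes x y z) + 𝟙 (outside z))              ≡⟨ Σv-+₃ (λ _ → 3) (λ z → 2 * 𝟙 (completes x y z)) (𝟙 ∘ outside) ⟩
      Σv (λ (_ : Fin n) → 3) + Σv (λ z → 2 * 𝟙 (completes x y z)) + count outside
        ≡⟨ cong₂ (λ s t → s + t + count outside) (trans (Σv-const 3) (*-comm n 3)) (∑-distribˡ-* 2 _ (allFin n)) ⟩
      3 * n + 2 * completions x y + count outside                          ∎
      where open ≤-Reasoning

    degree-pair₁ : ∀ x y → deg G x + deg G y + heavyDeg₁ x ≤ 3 * n + 2 * completions x y + count outside
    degree-pair₁ x y = degree-pair x y (λ z → in₁ z ∧ heavy x z) λ z →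
      weight-with-heavy₁ (μ G x z) (μ G y z) (in₁ z) (in₂ z) (μ-≤2 G x z) (μ-≤2 G y z) (U₁-disjoint-U₂ z)

    degree-pair₂ : ∀ x y → deg G x + deg G y + heavyDeg₂ y ≤ 3 * n + 2 * completions x y + count outside
    degree-pair₂ x y = degree-pair x y (λ z → in₂ z ∧ heavy y z) λ z →
      weight-with-heavy₂ (μ G x z) (μ G y z) (in₁ z) (in₂ z) (μ-≤2 G x z) (μ-≤2 G y z) (U₁-disjoint-U₂ z)

    -- Γ / q plays the role of γ n: rich₁ x says that x has at least γ n / 2 heavy neighbours in U₁.
    module Threshold (q Γ : ℕ) where

      rich₁ rich₂ : Fin n → Bool
      rich₁ x = Γ ≤ᵇ 2 * q * heavyDeg₁ x
      rich₂ y = Γ ≤ᵇ 2 * q * heavyDeg₂ y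

      poor₁ : Fin n → Bool
      poor₁ x = in₁ x ∧ not (rich₁ x)

      goodPair : Fin n → Fin n → Bool
      goodPair x y = in₁ x ∧ in₂ y ∧ heavy x y ∧ (rich₁ x ∨ rich₂ y)

      witness : Triple n → Bool
      witness (x , y , z) = goodPair x y ∧ completes x y z

      richCount₂ heavyPairs₂ goodPairs : ℕ
      richCount₂  = count λ y → in₂ y ∧ rich₂ y
      heavyPairs₂ = Σv λ x → Σv λ y → 𝟙 (in₂ x ∧ in₂ y ∧ heavy x y)
      goodPairs   = Σv λ x → Σv λ y → 𝟙 (goodPair x y)

      heavyToRich₂ : Fin n → ℕ
      heavyToRich₂ x = count λ y → in₂ y ∧ rich₂ y ∧ heavy x y

      e₂In≤heavyPairs₂ : e₂In G U₂ ≤ heavyPairs₂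
      e₂In≤heavyPairs₂ = ∑-mono-≤ (allFin n) λ x → ∑-mono-≤ (allFin n) λ y →
        ordered≤ (in₂ x) (in₂ y) (toℕ x <ᵇ toℕ y) (heavy x y)
        where
        ordered≤ : ∀ u v w h → (if u ∧ v ∧ w then (if h then 1 else 0) else 0) ≤ 𝟙 (u ∧ v ∧ h)
        ordered≤ true  true  true  true  = ≤-refl
        ordered≤ true  true  true  false = z≤n
        ordered≤ true  true  false _     = z≤n
        ordered≤ true  false _     _     = z≤n
        ordered≤ false _     _     _     = z≤n

      heavyPairs₂-bound : 2 * q * heavyPairs₂ ≤ 2 * q * count in₂ * richCount₂ + Γ * count in₂
      heavyPairs₂-bound = begin
        2 * q * heavyPairs₂
          ≡⟨ ∑-distribˡ-* (2 * q) _ (allFin n) ⟨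
        Σv (λ x → 2 * q * Σv λ y → 𝟙 (in₂ x ∧ in₂ y ∧ heavy x y))
          ≤⟨ ∑-mono-≤ (allFin n) pointwise ⟩
        Σv (λ x → 2 * q * count in₂ * 𝟙 (in₂ x ∧ rich₂ x) + Γ * 𝟙 (in₂ x))
          ≡⟨ ∑-distrib-+ _ _ (allFin n) ⟩
        Σv (λ x → 2 * q * count in₂ * 𝟙 (in₂ x ∧ rich₂ x)) + Σv (λ x → Γ * 𝟙 (in₂ x))
          ≡⟨ cong₂ _+_ (∑-distribˡ-* (2 * q * count in₂) _ (allFin n)) (∑-distribˡ-* Γ _ (allFin n)) ⟩
        2 * q * count in₂ * richCount₂ + Γ * count in₂ ∎
        where
        open ≤-Reasoning
        heavyDeg₂≤count : ∀ x → heavyDeg₂ x ≤ count in₂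
        heavyDeg₂≤count x = count-mono λ z → proj₁ ∘ to T-∧
        pointwise : ∀ x → 2 * q * (Σv λ y → 𝟙 (in₂ x ∧ in₂ y ∧ heavy x y))
                          ≤ 2 * q * count in₂ * 𝟙 (in₂ x ∧ rich₂ x) + Γ * 𝟙 (in₂ x)
        pointwise x with in₂ x
        ... | false = ≤-trans (≤-reflexive (trans (cong (2 * q *_) Σv-zero) (*-zeroʳ (2 * q)))) z≤n
        ... | true with rich₂ x in x-rich
        ...   | true  = begin
          2 * q * heavyDeg₂ x                      ≤⟨ *-monoʳ-≤ (2 * q) (heavyDeg₂≤count x) ⟩
          2 * q * count in₂                        ≡⟨ *-identityʳ _ ⟨
          2 * q * count in₂ * 1                    ≤⟨ m≤m+n _ _ ⟩
          2 * q * count in₂ * 1 + Γ * 1            ∎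
        ...   | false = begin
          2 * q * heavyDeg₂ x                      ≤⟨ ≤ᵇ-false⇒≥ x-rich ⟩
          Γ                                        ≡⟨ *-identityʳ Γ ⟨
          Γ * 1                                    ≤⟨ m≤n+m _ _ ⟩
          2 * q * count in₂ * 0 + Γ * 1            ∎

      heavyDeg₂+richCount₂ : ∀ x → heavyDeg₂ x + richCount₂ ≤ heavyToRich₂ x + count in₂
      heavyDeg₂+richCount₂ x = begin
        heavyDeg₂ x + richCount₂
          ≡⟨ ∑-distrib-+ (λ z → 𝟙 (in₂ z ∧ heavy x z)) (λ z → 𝟙 (in₂ z ∧ rich₂ z)) (allFin n) ⟨
        Σv (λ z → 𝟙 (in₂ z ∧ heavy x z) + 𝟙 (in₂ z ∧ rich₂ z))
          ≤⟨ ∑-mono-≤ (allFin n) (λ z → inclusion-exclusion (in₂ z) (rich₂ z) (heavy x z)) ⟩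
        Σv (λ z → 𝟙 (in₂ z ∧ rich₂ z ∧ heavy x z) + 𝟙 (in₂ z))
          ≡⟨ ∑-distrib-+ (λ z → 𝟙 (in₂ z ∧ rich₂ z ∧ heavy x z)) (𝟙 ∘ in₂) (allFin n) ⟩
        heavyToRich₂ x + count in₂ ∎
        where
        open ≤-Reasoning
        inclusion-exclusion : ∀ v r h → 𝟙 (v ∧ h) + 𝟙 (v ∧ r) ≤ 𝟙 (v ∧ r ∧ h) + 𝟙 v
        inclusion-exclusion false r     h     = z≤n
        inclusion-exclusion true  true  true  = ≤-refl
        inclusion-exclusion true  true  false = ≤-refl
        inclusion-exclusion true  false true  = ≤-refl
        inclusion-exclusion true  false false = z≤n

      e₂Between≤goodPairs+poor : e₂Between G U₁ U₂ ≤ goodPairs + n * count poor₁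
      e₂Between≤goodPairs+poor = begin
        e₂Between G U₁ U₂
          ≤⟨ ∑-mono-≤ (allFin n) (λ x → row x (in₁ x) (rich₁ x)) ⟩
        Σv (λ x → Σv (λ y → 𝟙 (goodPair x y)) + n * 𝟙 (poor₁ x))
          ≡⟨ ∑-distrib-+ _ _ (allFin n) ⟩
        goodPairs + Σv (λ x → n * 𝟙 (poor₁ x))
          ≡⟨ cong (goodPairs +_) (∑-distribˡ-* n _ (allFin n)) ⟩
        goodPairs + n * count poor₁ ∎
        where
        open ≤-Reasoning
        row : ∀ x u r → Σv (λ y → if u ∧ in₂ y then (if heavy x y then 1 else 0) else 0)
                        ≤ Σv (λ y → 𝟙 (u ∧ in₂ y ∧ heavy x y ∧ (r ∨ rich₂ y))) + n * 𝟙 (u ∧ not r)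
        row x false r     = ≤-trans (≤-reflexive Σv-zero) z≤n
        row x true  true  = ≤-trans (∑-mono-≤ (allFin n) λ y → heavy≤ (in₂ y) (heavy x y)) (m≤m+n _ _)
          where
          heavy≤ : ∀ v h → (if v then (if h then 1 else 0) else 0) ≤ 𝟙 (v ∧ h ∧ true)
          heavy≤ true  true  = ≤-refl
          heavy≤ true  false = z≤n
          heavy≤ false h     = z≤n
        row x true  false = begin
          Σv (λ y → if in₂ y then (if heavy x y then 1 else 0) else 0) ≤⟨ ∑-mono-≤ (allFin n) (λ y → ≤1 (in₂ y) (heavy x y)) ⟩
          Σv (λ (_ : Fin n) → 1)                                       ≡⟨ trans Σv-one (sym (*-identityʳ n)) ⟩
          n * 1                                                        ≤⟨ m≤n+m _ _ ⟩
          _                                                            ∎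
          where
          ≤1 : ∀ v h → (if v then (if h then 1 else 0) else 0) ≤ 1
          ≤1 true  true  = ≤-refl
          ≤1 true  false = z≤n
          ≤1 false h     = z≤n

      poor₁⇒heavyToRich₂≤ : ∀ x → T (poor₁ x) → heavyToRich₂ x ≤ Σv (λ y → 𝟙 (goodPair x y))
      poor₁⇒heavyToRich₂≤ x x-poor = count-mono λ y → rich-neighbour (in₁ x) (rich₁ x) (in₂ y) (rich₂ y) (heavy x y) x-poor
        where
        rich-neighbour : ∀ u r v ρ h → T (u ∧ not r) → T (v ∧ ρ ∧ h) → T (u ∧ v ∧ h ∧ (r ∨ ρ))
        rich-neighbour true false true true true _ _ = _

      witness⇒goodUnordered : ∀ t → T (witness t) → GoodUnordered G U₁ U₂ t
      witness⇒goodUnordered (x , y , z) w =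
        let pair , xyz  = to T-∧ w
            x∈U₁ , rest = to T-∧ pair
            y∈U₂ , rest = to T-∧ rest
        in heavyEdge+commonNeighbour⇒goodUnordered G U₁ U₂ (member U₁ x∈U₁) (member U₂ y∈U₂) (heavy⇒Heavy (proj₁ (to T-∧ rest)))
             (Sum.map common₁ common₂ (to T-∨ xyz))
        where
        member : ∀ (U : Subset n) {z} → T (lookup U z) → z ∈ U
        member U {z} t = lookup⇒[]= z U (to T-≡ t)
        heavy⇒Heavy : ∀ {a b} → T (heavy a b) → Heavy G a b
        heavy⇒Heavy = ≡ᵇ⇒≡ _ 2
        common₁ : T (in₁ z ∧ heavy x z ∧ adjacent y z) → z ∈ U₁ × Heavy G x z × 1 ≤ μ G y z
        common₁ t = let z∈U₁ , r = to T-∧ t ; xz , yz = to T-∧ r in member U₁ z∈U₁ , heavy⇒Heavy xz , ≤ᵇ⇒≤ 1 _ yz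
        common₂ : T (in₂ z ∧ heavy y z ∧ adjacent x z) → z ∈ U₂ × Heavy G y z × 1 ≤ μ G x z
        common₂ t = let z∈U₂ , r = to T-∧ t ; yz , xz = to T-∧ r in member U₂ z∈U₂ , heavy⇒Heavy yz , ≤ᵇ⇒≤ 1 _ xz

      U₂-small : 5 * q * n ≤ 10 * q * count in₁ + 2 * Γ → 10 * q * count in₂ ≤ 5 * q * n + 2 * Γ
      U₂-small U₁-large = subst (λ k → 10 * q * count in₂ ≤ 5 * q * k + 2 * Γ) sizes-partition
        (complement-bound q Γ (count in₁) (count in₂) (count outside)
          (subst (λ k → 5 * q * k ≤ 10 * q * count in₁ + 2 * Γ) (sym sizes-partition) U₁-large))

      -- The paper's hypotheses multiplied by q; e.g. deg-large is δ(G) ≥ (3/2 − γ/100) n.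
      module Dense
        (deg-large : ∀ x → 150 * q * n ≤ 100 * q * deg G x + Γ)
        (U₁-large : 5 * q * n ≤ 10 * q * count in₁ + 2 * Γ)
        (U₂-large : 5 * q * n ≤ 10 * q * count in₂ + 2 * Γ)
        (e₂U₂-large : Γ * n ≤ q * e₂In G U₂)
        (e₂U₁U₂-large : Γ * n ≤ q * e₂Between G U₁ U₂)
        (2Γ≤qn : 2 * Γ ≤ q * n)
        .{{_ : NonZero q}} .{{_ : NonZero n}}
        where

        private
          rich-end : ∀ a b c r s → T (a ∧ b ∧ c ∧ (r ∨ s)) → T r ⊎ T s
          rich-end true true true r s = to T-∨

          c₁ c₂ o : ℕ
          c₁ = count in₁
          c₂ = count in₂
          o  = count outside

          with-partition : ∀ {m} → 5 * q * n ≤ m → 5 * q * (c₁ + c₂ + o) ≤ m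
          with-partition = subst (λ k → 5 * q * k ≤ _) (sym sizes-partition)

        outside-small : 10 * q * o ≤ 4 * Γ
        outside-small = outside-bound q Γ c₁ c₂ o (with-partition U₁-large) (with-partition U₂-large)

        many-rich₂ : 7 * Γ ≤ 6 * q * richCount₂
        many-rich₂ = rich-count-bound q n Γ (e₂In G U₂) heavyPairs₂ c₂ richCount₂
                       e₂U₂-large e₂In≤heavyPairs₂ heavyPairs₂-bound (U₂-small U₁-large) 2Γ≤qn

        goodPair⇒many-completions : ∀ x y → T (goodPair x y) → Γ ≤ 25 * q * completions x y
        goodPair⇒many-completions x y good with rich-end (in₁ x) (in₂ y) (heavy x y) (rich₁ x) (rich₂ y) good
        ... | inj₁ x-rich = completion-bound q n Γ (deg G x) (deg G y) (heavyDeg₁ x) (completions x y) o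
                              (deg-large x) (deg-large y) (≤ᵇ⇒≤ Γ _ x-rich) outside-small (degree-pair₁ x y)
        ... | inj₂ y-rich = completion-bound q n Γ (deg G x) (deg G y) (heavyDeg₂ y) (completions x y) o
                              (deg-large x) (deg-large y) (≤ᵇ⇒≤ Γ _ y-rich) outside-small (degree-pair₂ x y)

        poor₁⇒many-rich-neighbours : ∀ x → T (poor₁ x) → 17 * Γ ≤ 300 * q * heavyToRich₂ x
        poor₁⇒many-rich-neighbours x x-poor = poor-richNeighbours-bound q n Γ (heavyDeg₂ x) richCount₂ (heavyToRich₂ x) c₂
          (heavyDeg₂+richCount₂ x)
          (poor-heavyDeg-bound q n Γ (deg G x) (heavyDeg x) (heavyDeg₁ x) (heavyDeg₂ x) o
            (deg-large x) (deg≤n+heavyDeg x) (heavyDeg-split x) (≤ᵇ-false⇒≥ (not-rich (in₁ x) (rich₁ x) x-poor)) outside-small)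
          many-rich₂ (U₂-small U₁-large)
          where
          not-rich : ∀ u r → T (u ∧ not r) → r ≡ false
          not-rich true false _ = refl

        many-goodPairs : 17 * Γ * Γ ≤ 600 * q * q * goodPairs
        many-goodPairs = good-pairs-bound q n Γ goodPairs (count poor₁) (e₂Between G U₁ U₂)
          e₂Between≤goodPairs+poor e₂U₁U₂-large poor-bound 2Γ≤qn
          where
          open ≤-Reasoning
          pointwise : ∀ x → 17 * Γ * 𝟙 (poor₁ x) ≤ 300 * q * Σv (λ y → 𝟙 (goodPair x y))
          pointwise x with poor₁ x in x-poor
          ... | false = ≤-trans (≤-reflexive (*-zeroʳ (17 * Γ))) z≤n
          ... | true  = begin
            17 * Γ * 1                              ≡⟨ *-identityʳ (17 * Γ) ⟩
            17 * Γ                                  ≤⟨ poor₁⇒many-rich-neighbours x (subst T (sym x-poor) _) ⟩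
            300 * q * heavyToRich₂ x                ≤⟨ *-monoʳ-≤ (300 * q) (poor₁⇒heavyToRich₂≤ x (subst T (sym x-poor) _)) ⟩
            300 * q * Σv (λ y → 𝟙 (goodPair x y))  ∎
          poor-bound : 17 * Γ * count poor₁ ≤ 300 * q * goodPairs
          poor-bound = begin
            17 * Γ * count poor₁                                   ≡⟨ ∑-distribˡ-* (17 * Γ) _ (allFin n) ⟨
            Σv (λ x → 17 * Γ * 𝟙 (poor₁ x))                        ≤⟨ ∑-mono-≤ (allFin n) pointwise ⟩
            Σv (λ x → 300 * q * Σv (λ y → 𝟙 (goodPair x y)))      ≡⟨ ∑-distribˡ-* (300 * q) _ (allFin n) ⟩
            300 * q * goodPairs                                    ∎

        many-witnesses : Γ * goodPairs ≤ 25 * q * ∑ triples (𝟙 ∘ witness)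
        many-witnesses = begin
          Γ * goodPairs
            ≡⟨ trans (∑-cong (allFin n) λ x → ∑-distribˡ-* Γ _ (allFin n)) (∑-distribˡ-* Γ _ (allFin n)) ⟨
          Σv (λ x → Σv λ y → Γ * 𝟙 (goodPair x y))
            ≤⟨ ∑-mono-≤ (allFin n) (λ x → ∑-mono-≤ (allFin n) (pointwise x)) ⟩
          Σv (λ x → Σv λ y → 25 * q * Σv λ z → 𝟙 (goodPair x y ∧ completes x y z))
            ≡⟨ trans (∑-cong (allFin n) λ x → ∑-distribˡ-* (25 * q) _ (allFin n)) (∑-distribˡ-* (25 * q) _ (allFin n)) ⟩
          25 * q * (Σv λ x → Σv λ y → Σv λ z → 𝟙 (witness (x , y , z)))
            ≡⟨ cong (25 * q *_) (∑-triples (𝟙 ∘ witness)) ⟨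
          25 * q * ∑ triples (𝟙 ∘ witness) ∎
          where
          open ≤-Reasoning
          pointwise : ∀ x y → Γ * 𝟙 (goodPair x y) ≤ 25 * q * Σv (λ z → 𝟙 (goodPair x y ∧ completes x y z))
          pointwise x y with goodPair x y in xy-good
          ... | false = ≤-trans (≤-reflexive (*-zeroʳ Γ)) z≤n
          ... | true  = ≤-trans (≤-reflexive (*-identityʳ Γ)) (goodPair⇒many-completions x y (subst T (sym xy-good) _))

        many-goodTriples : Γ * Γ * Γ ≤ 6000 * (q * q * q * length (goodTriples G U₁ U₂))
        many-goodTriples = good-triples-bound q Γ goodPairs (∑ triples (𝟙 ∘ witness)) (length (goodTriples G U₁ U₂))
          many-goodPairs many-witnesses (count-goodUnordered≤6*goodTriples G U₁ U₂ witness witness⇒goodUnordered)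

open import Defs
open import Data.Nat.Base as ℕ using (ℕ; suc; s≤s; z≤n)
  renaming (_≤_ to _≤ℕ_; _<_ to _<ℕ_; _+_ to _+ℕ_; _*_ to _*ℕ_)
import Data.Nat.Properties as ℕ
open import Data.Integer.Base as ℤ using (+_)
import Data.Integer.Properties as ℤ
open import Data.Rational.Base renaming (∣_∣ to abs)
open import Data.Rational.Properties
import Data.Rational.Unnormalised.Base as ℚᵘ
import Data.Rational.Unnormalised.Properties as ℚᵘ
open import Data.Rational.Solver using (module +-*-Solver)
open import Data.Bool.Base using (true; false)
open import Data.Fin.Subset using (Subset; ∣_∣)
open import Data.Vec.Base using (lookup)
open import Data.Vec.Properties using (lookup⇒[]=)
open import Data.List.Base using (List; length)
open import Data.List.Relation.Unary.All using (All)
open import Data.List.Relation.Unary.Unique.Propositional using (Unique)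
open import Data.Product.Base using (Σ; _×_; _,_)
open import Data.Sum.Base using (inj₁; inj₂)
open import Relation.Binary.PropositionalEquality
open import Relation.Nullary.Negation using (¬_; contradiction)
open ℕ→ℚ-Properties
open Inequalities
open GoodTriples
open Counting

open +-*-Solver using (solve; _:+_; _:-_; :-_; _:*_; _:=_; con)

record SmallFraction (γ : ℚ) : Set where
  field
    p q    : ℕ
    1≤p    : 1 ≤ℕ p
    100p≤q : 100 *ℕ p ≤ℕ q
    qγ≡p   : ℕ→ℚ q * γ ≡ ℕ→ℚ p

smallFraction : ∀ γ → 0ℚ < γ → γ ≤ + 1 / 100 → SmallFraction γ
smallFraction γ@(mkℚ (+ suc m) d _) _ γ≤1/100 = record
  { p = suc m ; q = suc d ; 1≤p = s≤s z≤n ; 100p≤q = 100p≤q γ≤1/100 ; qγ≡p = qγ≡p }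
  where
  100p≤q : γ ≤ + 1 / 100 → 100 *ℕ suc m ≤ℕ suc d
  100p≤q (*≤* le) = subst₂ _≤ℕ_ (ℕ.*-comm (suc m) 100) (ℕ.*-identityˡ (suc d)) (ℤ.drop‿+≤+ le)
  qγ≡p : ℕ→ℚ (suc d) * γ ≡ ℕ→ℚ (suc m)
  qγ≡p = toℚᵘ-injective (begin-equality
    toℚᵘ (ℕ→ℚ (suc d) * γ)                ≃⟨ toℚᵘ-homo-* (ℕ→ℚ (suc d)) γ ⟩
    toℚᵘ (ℕ→ℚ (suc d)) ℚᵘ.* toℚᵘ γ         ≡⟨ cong (ℚᵘ._* toℚᵘ γ) (toℚᵘ-ℕ→ℚ (suc d)) ⟩
    ℚᵘ.mkℚᵘ (+ suc d) 0 ℚᵘ.* toℚᵘ γ        ≃⟨ ℚᵘ.*≡* cross ⟩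
    ℚᵘ.mkℚᵘ (+ suc m) 0                    ≡⟨ toℚᵘ-ℕ→ℚ (suc m) ⟨
    toℚᵘ (ℕ→ℚ (suc m))                     ∎)
    where
    open ℚᵘ.≤-Reasoning
    cross : (+ suc d ℤ.* + suc m) ℤ.* + 1 ≡ + suc m ℤ.* + suc (d +ℕ 0)
    cross = trans (ℤ.*-identityʳ _) (trans (ℤ.*-comm (+ suc d) (+ suc m)) (cong (λ w → + suc m ℤ.* + suc w) (sym (ℕ.+-identityʳ d))))
smallFraction (mkℚ (+ 0) _ _) (*<* (ℤ.+<+ ())) _
smallFraction (mkℚ ℤ.-[1+ _ ] _ _) (*<* ()) _

module Scaled {γ : ℚ} (F : SmallFraction γ) where

  open SmallFraction F public

  instance
    q≢0 : ℕ.NonZero q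
    q≢0 = ℕ.>-nonZero (ℕ.≤-trans (ℕ.≤-trans (s≤s z≤n) (ℕ.*-monoʳ-≤ 100 1≤p)) 100p≤q)

  private
    Q : ℚ
    Q = ℕ→ℚ q

    ℕ→ℚ-homo-*₃ : ∀ a b c → ℕ→ℚ (a *ℕ b *ℕ c) ≡ ℕ→ℚ a * ℕ→ℚ b * ℕ→ℚ c
    ℕ→ℚ-homo-*₃ a b c = trans (ℕ→ℚ-homo-* (a *ℕ b) c) (cong (_* ℕ→ℚ c) (ℕ→ℚ-homo-* a b))

    pm≡Qγm : ∀ m → ℕ→ℚ (p *ℕ m) ≡ Q * γ * ℕ→ℚ m
    pm≡Qγm m = trans (ℕ→ℚ-homo-* p m) (cong (_* ℕ→ℚ m) (sym qγ≡p))

    2pm≡2Qγm : ∀ m → ℕ→ℚ (2 *ℕ (p *ℕ m)) ≡ ℕ→ℚ 2 * (Q * γ * ℕ→ℚ m)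
    2pm≡2Qγm m = trans (ℕ→ℚ-homo-* 2 (p *ℕ m)) (cong (ℕ→ℚ 2 *_) (pm≡Qγm m))

    x-0≡x : ∀ x → x - ℕ→ℚ 0 ≡ x
    x-0≡x = +-identityʳ

    scaled-ℕ : ∀ k u → ℕ→ℚ k * ℕ→ℚ u ≡ ℕ→ℚ (k *ℕ u)
    scaled-ℕ k u = sym (ℕ→ℚ-homo-* k u)

  size⇒scaled : ∀ n u → (½ - γ * (+ 1 / 5)) * ℕ→ℚ n ≤ ℕ→ℚ u →
                5 *ℕ q *ℕ n ≤ℕ 10 *ℕ q *ℕ u +ℕ 2 *ℕ (p *ℕ n)
  size⇒scaled n u = ≤⇒ℕ-≤ (10 *ℕ q) {{ℕ.m*n≢0 10 q}} (5 *ℕ q *ℕ n) (2 *ℕ (p *ℕ n)) (10 *ℕ q *ℕ u) 10q-size (scaled-ℕ (10 *ℕ q) u)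
    where
    open ClearDenominators
    10q-size : ℕ→ℚ (10 *ℕ q) * ((½ - γ * (+ 1 / 5)) * ℕ→ℚ n) ≡ ℕ→ℚ (5 *ℕ q *ℕ n) - ℕ→ℚ (2 *ℕ (p *ℕ n))
    10q-size = begin
      ℕ→ℚ (10 *ℕ q) * ((½ - γ * (+ 1 / 5)) * ℕ→ℚ n)      ≡⟨ cong (_* _) (ℕ→ℚ-homo-* 10 q) ⟩
      ℕ→ℚ 10 * Q * ((½ - γ * (+ 1 / 5)) * ℕ→ℚ n)          ≡⟨ solve 3 (λ g Q N → con (ℕ→ℚ 10) :* Q :* ((con ½ :- g :* con (+ 1 / 5)) :* N)
                                                                   := con (ℕ→ℚ 5) :* Q :* N :- con (ℕ→ℚ 2) :* (Q :* g :* N)) refl γ Q (ℕ→ℚ n) ⟩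
      ℕ→ℚ 5 * Q * ℕ→ℚ n - ℕ→ℚ 2 * (Q * γ * ℕ→ℚ n)         ≡⟨ cong₂ _-_ (ℕ→ℚ-homo-*₃ 5 q n) (2pm≡2Qγm n) ⟨
      ℕ→ℚ (5 *ℕ q *ℕ n) - ℕ→ℚ (2 *ℕ (p *ℕ n))         ∎
      where open ≡-Reasoning

  degree⇒scaled : ∀ n d η → η ≤ γ * (+ 1 / 200) → (+ 3 / 2 - (+ 2 / 1) * η) * ℕ→ℚ n ≤ ℕ→ℚ d →
                  150 *ℕ q *ℕ n ≤ℕ 100 *ℕ q *ℕ d +ℕ p *ℕ n
  degree⇒scaled n d η η≤γ/200 δ≤d = ≤⇒ℕ-≤ (100 *ℕ q) {{ℕ.m*n≢0 100 q}} (150 *ℕ q *ℕ n) (p *ℕ n) (100 *ℕ q *ℕ d)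
    100q-degree (scaled-ℕ (100 *ℕ q) d) (≤-trans weaker δ≤d)
    where
    open ClearDenominators
    weaker : (+ 3 / 2 - (+ 2 / 1) * (γ * (+ 1 / 200))) * ℕ→ℚ n ≤ (+ 3 / 2 - (+ 2 / 1) * η) * ℕ→ℚ n
    weaker = *-monoʳ-≤-nonNeg (ℕ→ℚ n) {{ℕ→ℚ-nonNegative n}}
               (+-monoʳ-≤ (+ 3 / 2) (neg-antimono-≤ (*-monoˡ-≤-nonNeg (+ 2 / 1) η≤γ/200)))
    100q-degree : ℕ→ℚ (100 *ℕ q) * ((+ 3 / 2 - (+ 2 / 1) * (γ * (+ 1 / 200))) * ℕ→ℚ n)
                  ≡ ℕ→ℚ (150 *ℕ q *ℕ n) - ℕ→ℚ (p *ℕ n)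
    100q-degree = begin
      ℕ→ℚ (100 *ℕ q) * ((+ 3 / 2 - (+ 2 / 1) * (γ * (+ 1 / 200))) * ℕ→ℚ n)
        ≡⟨ cong (_* _) (ℕ→ℚ-homo-* 100 q) ⟩
      ℕ→ℚ 100 * Q * ((+ 3 / 2 - (+ 2 / 1) * (γ * (+ 1 / 200))) * ℕ→ℚ n)
        ≡⟨ solve 3 (λ g Q N → con (ℕ→ℚ 100) :* Q :* ((con (+ 3 / 2) :- con (+ 2 / 1) :* (g :* con (+ 1 / 200))) :* N)
                              := con (ℕ→ℚ 150) :* Q :* N :- Q :* g :* N) refl γ Q (ℕ→ℚ n) ⟩
      ℕ→ℚ 150 * Q * ℕ→ℚ n - Q * γ * ℕ→ℚ n
        ≡⟨ cong₂ _-_ (ℕ→ℚ-homo-*₃ 150 q n) (pm≡Qγm n) ⟨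
      ℕ→ℚ (150 *ℕ q *ℕ n) - ℕ→ℚ (p *ℕ n) ∎
      where open ≡-Reasoning

  private
    Q*e≡qe-0 : ∀ e → Q * ℕ→ℚ e ≡ ℕ→ℚ (q *ℕ e) - ℕ→ℚ 0
    Q*e≡qe-0 e = trans (scaled-ℕ q e) (sym (x-0≡x _))

    Q*γm≡pm : ∀ m → Q * (γ * ℕ→ℚ m) ≡ ℕ→ℚ (p *ℕ m)
    Q*γm≡pm m = trans (sym (*-assoc Q γ (ℕ→ℚ m))) (sym (pm≡Qγm m))

    2Q*γm≡2pm : ∀ m → ℕ→ℚ (2 *ℕ q) * (γ * ℕ→ℚ m) ≡ ℕ→ℚ (2 *ℕ (p *ℕ m))
    2Q*γm≡2pm m = trans (cong (_* _) (ℕ→ℚ-homo-* 2 q))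
      (trans (solve 3 (λ g Q M → con (ℕ→ℚ 2) :* Q :* (g :* M) := con (ℕ→ℚ 2) :* (Q :* g :* M)) refl γ Q (ℕ→ℚ m))
        (sym (2pm≡2Qγm m)))

  scaled⇒<γ* : ∀ e m → q *ℕ e <ℕ p *ℕ m → ℕ→ℚ e < γ * ℕ→ℚ m
  scaled⇒<γ* e m qe<pm = ClearDenominators.ℕ-<⇒< q (q *ℕ e) 0 (p *ℕ m) (Q*e≡qe-0 e) (Q*γm≡pm m)
    (subst (q *ℕ e <ℕ_) (sym (ℕ.+-identityʳ _)) qe<pm)

  scaled⇒≤γ* : ∀ e m → q *ℕ e ≤ℕ p *ℕ m → ℕ→ℚ e ≤ γ * ℕ→ℚ m
  scaled⇒≤γ* e m qe≤pm = ClearDenominators.ℕ-≤⇒≤ q (q *ℕ e) 0 (p *ℕ m) (Q*e≡qe-0 e) (Q*γm≡pm m)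
    (subst (q *ℕ e ≤ℕ_) (sym (ℕ.+-identityʳ _)) qe≤pm)

  scaled⇒near-half : ∀ n c → 2 *ℕ q *ℕ c <ℕ q *ℕ n +ℕ 2 *ℕ (p *ℕ n) → q *ℕ n <ℕ 2 *ℕ q *ℕ c +ℕ 2 *ℕ (p *ℕ n) →
                     abs (ℕ→ℚ c - ½ * ℕ→ℚ n) < γ * ℕ→ℚ n
  scaled⇒near-half n c above below with ∣p∣≡p∨∣p∣≡-p (ℕ→ℚ c - ½ * ℕ→ℚ n)
  ... | inj₁ ∣x∣≡x  = subst (_< γ * ℕ→ℚ n) (sym ∣x∣≡x)
    (ℕ-<⇒< (2 *ℕ q) {{ℕ.m*n≢0 2 q}} (2 *ℕ q *ℕ c) (q *ℕ n) (2 *ℕ (p *ℕ n)) 2q-excess (2Q*γm≡2pm n)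
      (subst (2 *ℕ q *ℕ c <ℕ_) (ℕ.+-comm _ (2 *ℕ (p *ℕ n))) above))
    where
    open ClearDenominators
    2q-excess : ℕ→ℚ (2 *ℕ q) * (ℕ→ℚ c - ½ * ℕ→ℚ n) ≡ ℕ→ℚ (2 *ℕ q *ℕ c) - ℕ→ℚ (q *ℕ n)
    2q-excess = trans (cong (_* _) (ℕ→ℚ-homo-* 2 q))
      (trans (solve 3 (λ C Q N → con (ℕ→ℚ 2) :* Q :* (C :- con ½ :* N) := con (ℕ→ℚ 2) :* Q :* C :- Q :* N) refl (ℕ→ℚ c) Q (ℕ→ℚ n))
        (sym (cong₂ _-_ (ℕ→ℚ-homo-*₃ 2 q c) (ℕ→ℚ-homo-* q n))))
  ... | inj₂ ∣x∣≡-x = subst (_< γ * ℕ→ℚ n) (sym ∣x∣≡-x)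
    (ℕ-<⇒< (2 *ℕ q) {{ℕ.m*n≢0 2 q}} (q *ℕ n) (2 *ℕ q *ℕ c) (2 *ℕ (p *ℕ n)) 2q-deficit (2Q*γm≡2pm n)
      (subst (q *ℕ n <ℕ_) (ℕ.+-comm _ (2 *ℕ (p *ℕ n))) below))
    where
    open ClearDenominators
    2q-deficit : ℕ→ℚ (2 *ℕ q) * (- (ℕ→ℚ c - ½ * ℕ→ℚ n)) ≡ ℕ→ℚ (q *ℕ n) - ℕ→ℚ (2 *ℕ q *ℕ c)
    2q-deficit = trans (cong (_* _) (ℕ→ℚ-homo-* 2 q))
      (trans (solve 3 (λ C Q N → con (ℕ→ℚ 2) :* Q :* (:- (C :- con ½ :* N)) := Q :* N :- con (ℕ→ℚ 2) :* Q :* C) refl (ℕ→ℚ c) Q (ℕ→ℚ n))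
        (sym (cong₂ _-_ (ℕ→ℚ-homo-* q n) (ℕ→ℚ-homo-*₃ 2 q c))))

  scaled⇒half-minus-γ : ∀ n c → q *ℕ n ≤ℕ 2 *ℕ q *ℕ c +ℕ 2 *ℕ (p *ℕ n) → (½ - γ) * ℕ→ℚ n ≤ ℕ→ℚ c
  scaled⇒half-minus-γ n c = ClearDenominators.ℕ-≤⇒≤ (2 *ℕ q) {{ℕ.m*n≢0 2 q}} (q *ℕ n) (2 *ℕ (p *ℕ n)) (2 *ℕ q *ℕ c)
    2q-half (scaled-ℕ (2 *ℕ q) c)
    where
    2q-half : ℕ→ℚ (2 *ℕ q) * ((½ - γ) * ℕ→ℚ n) ≡ ℕ→ℚ (q *ℕ n) - ℕ→ℚ (2 *ℕ (p *ℕ n))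
    2q-half = trans (cong (_* _) (ℕ→ℚ-homo-* 2 q))
      (trans (solve 3 (λ g Q N → con (ℕ→ℚ 2) :* Q :* ((con ½ :- g) :* N) := Q :* N :- con (ℕ→ℚ 2) :* (Q :* g :* N)) refl γ Q (ℕ→ℚ n))
        (sym (cong₂ _-_ (ℕ→ℚ-homo-* q n) (2pm≡2Qγm n))))

  scaled⇒density : ∀ n L → p *ℕ n *ℕ (p *ℕ n) *ℕ (p *ℕ n) ≤ℕ 6000 *ℕ (q *ℕ q *ℕ q *ℕ L) →
                   γ * γ * γ * (+ 1 / 6000) * ℕ→ℚ (n *ℕ n *ℕ n) ≤ ℕ→ℚ L
  scaled⇒density n L bound = ClearDenominators.ℕ-≤⇒≤ k {{k≢0}} (pn *ℕ pn *ℕ pn) 0 (k *ℕ L)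
    k-density (scaled-ℕ k L)
    (subst (pn *ℕ pn *ℕ pn ≤ℕ_) (trans (sym (ℕ.*-assoc 6000 (q *ℕ q *ℕ q) L)) (sym (ℕ.+-identityʳ _))) bound)
    where
    pn k : ℕ
    pn = p *ℕ n
    k  = 6000 *ℕ (q *ℕ q *ℕ q)
    k≢0 : ℕ.NonZero k
    k≢0 = ℕ.m*n≢0 6000 (q *ℕ q *ℕ q) {{_}} {{ℕ.m*n≢0 (q *ℕ q) q {{ℕ.m*n≢0 q q}}}}
    k-density : ℕ→ℚ k * (γ * γ * γ * (+ 1 / 6000) * ℕ→ℚ (n *ℕ n *ℕ n)) ≡ ℕ→ℚ (pn *ℕ pn *ℕ pn) - ℕ→ℚ 0
    k-density = begin
      ℕ→ℚ k * (γ * γ * γ * (+ 1 / 6000) * ℕ→ℚ (n *ℕ n *ℕ n))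
        ≡⟨ cong₂ (λ K N³ → K * (γ * γ * γ * (+ 1 / 6000) * N³)) (trans (ℕ→ℚ-homo-* 6000 (q *ℕ q *ℕ q)) (cong (ℕ→ℚ 6000 *_) (ℕ→ℚ-homo-*₃ q q q))) (ℕ→ℚ-homo-*₃ n n n) ⟩
      ℕ→ℚ 6000 * (Q * Q * Q) * (γ * γ * γ * (+ 1 / 6000) * (ℕ→ℚ n * ℕ→ℚ n * ℕ→ℚ n))
        ≡⟨ solve 3 (λ g Q N → con (ℕ→ℚ 6000) :* (Q :* Q :* Q) :* (g :* g :* g :* con (+ 1 / 6000) :* (N :* N :* N))
                              := (Q :* g :* N) :* (Q :* g :* N) :* (Q :* g :* N)) refl γ Q (ℕ→ℚ n) ⟩
      (Q * γ * ℕ→ℚ n) * (Q * γ * ℕ→ℚ n) * (Q * γ * ℕ→ℚ n)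
        ≡⟨ trans (ℕ→ℚ-homo-*₃ pn pn pn) (cong₂ _*_ (cong₂ _*_ (pm≡Qγm n) (pm≡Qγm n)) (pm≡Qγm n)) ⟨
      ℕ→ℚ (pn *ℕ pn *ℕ pn)
        ≡⟨ x-0≡x _ ⟨
      ℕ→ℚ (pn *ℕ pn *ℕ pn) - ℕ→ℚ 0 ∎
      where open ≡-Reasoning

disjoint⇒lookup : ∀ {n} (U₁ U₂ : Subset n) → Disjoint U₁ U₂ → ∀ z → lookup U₁ z ≡ true → lookup U₂ z ≡ false
disjoint⇒lookup U₁ U₂ U₁#U₂ z z∈U₁ with lookup U₂ z in z∈U₂
... | true  = contradiction (lookup⇒[]= z U₂ z∈U₂) (U₁#U₂ z (lookup⇒[]= z U₁ z∈U₁))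
... | false = refl

module Density {γ : ℚ} (F : SmallFraction γ) {n : ℕ} (G : StdMultigraph n) (U₁ U₂ : Subset n) (U₁#U₂ : Disjoint U₁ U₂) where

  open Scaled F
  open Graph G U₁ U₂ (disjoint⇒lookup U₁ U₂ U₁#U₂)
  open Threshold q (p *ℕ n)

  size⇒scaled-count : ∀ (U : Subset n) → (½ - γ * (+ 1 / 5)) * ℕ→ℚ n ≤ ℕ→ℚ ∣ U ∣ →
                 5 *ℕ q *ℕ n ≤ℕ 10 *ℕ q *ℕ count (lookup U) +ℕ 2 *ℕ (p *ℕ n)
  size⇒scaled-count U large = subst (λ c → _ ≤ℕ 10 *ℕ q *ℕ c +ℕ _) (∣S∣≡count U) (size⇒scaled n ∣ U ∣ large)

  module _ (U₁-large : (½ - γ * (+ 1 / 5)) * ℕ→ℚ n ≤ ℕ→ℚ ∣ U₁ ∣) (U₂-large : (½ - γ * (+ 1 / 5)) * ℕ→ℚ n ≤ ℕ→ℚ ∣ U₂ ∣) where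

    private
      scaled-U₁ = size⇒scaled-count U₁ U₁-large
      scaled-U₂ = size⇒scaled-count U₂ U₂-large

      half-minus-γ : ∀ (U : Subset n) → 5 *ℕ q *ℕ n ≤ℕ 10 *ℕ q *ℕ count (lookup U) +ℕ 2 *ℕ (p *ℕ n) →
                     (½ - γ) * ℕ→ℚ n ≤ ℕ→ℚ ∣ U ∣
      half-minus-γ U scaled = subst (λ c → (½ - γ) * ℕ→ℚ n ≤ ℕ→ℚ c) (sym (∣S∣≡count U))
        (scaled⇒half-minus-γ n (count (lookup U)) (at-least-half q n (p *ℕ n) (count (lookup U)) scaled))

    nonExtremal⇒heavy-in-U₂ : 1 ≤ℕ n → ¬ Extremal γ G → p *ℕ n *ℕ n ≤ℕ q *ℕ e₂In G U₂
    nonExtremal⇒heavy-in-U₂ 1≤n ¬extremal = ℕ.≮⇒≥ λ few-heavy → ¬extremal (inj₂ (U₂ , near-half ,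
      scaled⇒<γ* (e₂In G U₂) (n *ℕ n) (subst (q *ℕ e₂In G U₂ <ℕ_) (ℕ.*-assoc p n n) few-heavy)))
      where
      1≤pn : 1 ≤ℕ p *ℕ n
      1≤pn = ℕ.*-mono-≤ 1≤p 1≤n
      near-half : abs (ℕ→ℚ ∣ U₂ ∣ - ½ * ℕ→ℚ n) < γ * ℕ→ℚ n
      near-half = subst (λ c → abs (ℕ→ℚ c - ½ * ℕ→ℚ n) < γ * ℕ→ℚ n) (sym (∣S∣≡count U₂))
        (scaled⇒near-half n (count in₂)
          (near-half-above q n (p *ℕ n) (count in₂) (U₂-small scaled-U₁) 1≤pn)
          (near-half-below q n (p *ℕ n) (count in₂) scaled-U₂ 1≤pn))

    nonSplittable⇒heavy-across : ¬ Splittable γ G → p *ℕ n *ℕ n ≤ℕ q *ℕ e₂Between G U₁ U₂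
    nonSplittable⇒heavy-across ¬splittable = ℕ.≮⇒≥ λ few-heavy → ¬splittable (U₁ , U₂ , U₁#U₂ ,
      half-minus-γ U₁ scaled-U₁ , half-minus-γ U₂ scaled-U₂ ,
      scaled⇒≤γ* (e₂Between G U₁ U₂) (n *ℕ n) (ℕ.<⇒≤ (subst (q *ℕ e₂Between G U₁ U₂ <ℕ_) (ℕ.*-assoc p n n) few-heavy)))

    goodTriples-dense : ∀ η → η ≤ γ * (+ 1 / 200) → 1 ≤ℕ n →
                        MinDegAtLeast G ((+ 3 / 2 - (+ 2 / 1) * η) * ℕ→ℚ n) → ¬ Extremal γ G → ¬ Splittable γ G →
                        γ * γ * γ * (+ 1 / 6000) * ℕ→ℚ (n *ℕ n *ℕ n) ≤ ℕ→ℚ (length (goodTriples G U₁ U₂))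
    goodTriples-dense η η≤γ/200 1≤n min-degree ¬extremal ¬splittable =
      scaled⇒density n (length (goodTriples G U₁ U₂)) (Dense.many-goodTriples
        (λ x → degree⇒scaled n (deg G x) η η≤γ/200 (min-degree x)) scaled-U₁ scaled-U₂
        (nonExtremal⇒heavy-in-U₂ 1≤n ¬extremal) (nonSplittable⇒heavy-across ¬splittable) 2pn≤qn {{q≢0}} {{ℕ.>-nonZero 1≤n}})
      where
      2pn≤qn : 2 *ℕ (p *ℕ n) ≤ℕ q *ℕ n
      2pn≤qn = ℕ.≤-trans (ℕ.*-monoˡ-≤ (p *ℕ n) (ℕ.≤ᵇ⇒≤ 2 100 _))
                         (ℕ.≤-trans (ℕ.≤-reflexive (sym (ℕ.*-assoc 100 p n))) (ℕ.*-monoˡ-≤ n 100p≤q))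

private
  cube/6000-positive : ∀ γ → 0ℚ < γ → 0ℚ < γ * γ * γ * (+ 1 / 6000)
  cube/6000-positive γ 0<γ = positive⁻¹ _ {{pos*pos⇒pos (γ * γ * γ) (+ 1 / 6000)}}
    where
    instance
      γ-positive  = positive 0<γ
      γ²-positive = pos*pos⇒pos γ γ
      γ³-positive = pos*pos⇒pos (γ * γ) γ

  /200-positive : ∀ γ → 0ℚ < γ → 0ℚ < γ * (+ 1 / 200)
  /200-positive γ 0<γ = positive⁻¹ _ {{pos*pos⇒pos γ {{positive 0<γ}} (+ 1 / 200)}}

lemma8p4 :
    Σ ℚ λ γ₀ → 0ℚ < γ₀ ×
    (∀ (γ : ℚ) → 0ℚ < γ → γ ≤ γ₀ →
      Σ ℚ λ λ₀ → 0ℚ < λ₀ ×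
      (∀ (lam : ℚ) → 0ℚ < lam → lam ≤ λ₀ →
        Σ ℚ λ η₀ → 0ℚ < η₀ ×
        (∀ (η : ℚ) → 0ℚ < η → η ≤ η₀ →
          Σ ℕ λ n₀ →
          (∀ (n : ℕ) → n₀ ≤ℕ n →
            (G : StdMultigraph n) →
            MinDegAtLeast G ((+ 3 / 2 - (+ 2 / 1) * η) * ℕ→ℚ n) →
            ¬ Extremal γ G →
            ¬ Splittable γ G →
            (U₁ U₂ : Subset n) →
            Disjoint U₁ U₂ →
            (½ - γ * (+ 1 / 5)) * ℕ→ℚ n ≤ ℕ→ℚ ∣ U₁ ∣ →
            (½ - γ * (+ 1 / 5)) * ℕ→ℚ n ≤ ℕ→ℚ ∣ U₂ ∣ →
            Σ (List (Triple n)) λ 𝒯 →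
              Unique 𝒯
              × All (GoodTriple G U₁ U₂) 𝒯
              × lam * ℕ→ℚ (n *ℕ n *ℕ n) ≤ ℕ→ℚ (length 𝒯)))))
lemma8p4 = + 1 / 100 , positive⁻¹ (+ 1 / 100) , λ γ 0<γ γ≤γ₀ →
  γ * γ * γ * (+ 1 / 6000) , cube/6000-positive γ 0<γ , λ lam _ lam≤λ₀ →
  γ * (+ 1 / 200) , /200-positive γ 0<γ , λ η _ η≤η₀ →
  1 , λ n 1≤n G min-degree ¬extremal ¬splittable U₁ U₂ U₁#U₂ U₁-large U₂-large →
    goodTriples G U₁ U₂ , goodTriples-unique G U₁ U₂ , goodTriples-good G U₁ U₂ ,
    ≤-trans (*-monoʳ-≤-nonNeg (ℕ→ℚ (n *ℕ n *ℕ n)) {{ℕ→ℚ-nonNegative (n *ℕ n *ℕ n)}} lam≤λ₀)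
      (Density.goodTriples-dense (smallFraction γ 0<γ γ≤γ₀) G U₁ U₂ U₁#U₂ U₁-large U₂-large η η≤η₀ 1≤n
        min-degree ¬extremal ¬splittable)
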